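{- Let $j\ge 1$ and $m\ge 1$ be integers. The $312$-avoiding permutations of $\{1,\ldots,(j+1)m\}$ whose up/down pattern is $D^jUD^jU\cdots UD^j$ (with $m$ blocks $D^j$) are in bijection with the $(j+2)$-angulations of a convex $(mj+2)$-gon.
   Context: A permutation $a_1a_2\ldots a_N$ is $312$-avoiding if there are no indices $i<j<k$ with $a_j<a_k<a_i$. The up/down pattern of a permutation $a_1\ldots a_N$ is the word $x_1\ldots x_{N-1}$, where $x_i=D$ if $a_i>a_{i+1}$ and $x_i=U$ if $a_i<a_{i+1}$. A $(j+2)$-angulation of a convex polygon is a dissection of it by non-crossing diagonals into regions that are all $(j+2)$-gons. -}

module Defs where

open import Data.Nat using (ℕ; zero; suc; _+_; _*_; _∸_; _<_; _≤_; _<ᵇ_)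
open import Data.Bool using (if_then_else_)
open import Data.Product using (_×_; _,_)
open import Data.Sum using (_⊎_)
open import Data.List using (List; []; _∷_; _++_; replicate; map; upTo; length)
open import Data.List.Membership.Propositional using (_∈_)
open import Data.List.Relation.Unary.Linked using (Linked)
open import Data.List.Relation.Binary.Permutation.Propositional using (_↭_)
open import Data.Vec using (Vec; lookup; toList)
import Data.Fin as F
open import Relation.Nullary using (¬_)
open import Relation.Binary.PropositionalEquality using (_≡_)

IsPerm : (N : ℕ) → Vec ℕ N → Set
IsPerm N a = toList a ↭ map suc (upTo N)

Avoids312 : {N : ℕ} → Vec ℕ N → Set
Avoids312 {N} a = (i j k : F.Fin N) → i F.< j → j F.< k →
  ¬ (lookup a j < lookup a k × lookup a k < lookup a i)

data UD : Set where
  U D : UD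

udList : List ℕ → List UD
udList [] = []
udList (x ∷ []) = []
udList (x ∷ y ∷ r) = (if y <ᵇ x then D else U) ∷ udList (y ∷ r)

udPattern : {N : ℕ} → Vec ℕ N → List UD
udPattern a = udList (toList a)

blocks : ℕ → ℕ → List UD
blocks j zero = []
blocks j (suc zero) = replicate j D
blocks j (suc (suc m)) = replicate j D ++ (U ∷ blocks j (suc m))

GoodPerm : (j m : ℕ) → Vec ℕ ((j + 1) * m) → Set
GoodPerm j m a = IsPerm ((j + 1) * m) a × Avoids312 a × udPattern a ≡ blocks j m

-- Dissections of a convex n-gon with vertices 0,1,…,n-1 in cyclic order.
-- A set of diagonals is represented canonically as a list of pairs (a,b),
-- a < b, strictly increasing in lexicographic order.

_<ᴾ_ : ℕ × ℕ → ℕ × ℕ → Set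
(a , b) <ᴾ (c , d) = a < c ⊎ (a ≡ c × b < d)

IsSide : ℕ → ℕ → ℕ → Set
IsSide n a b = b ≡ suc a ⊎ (a ≡ 0 × b ≡ n ∸ 1)

IsDiagonal : ℕ → ℕ × ℕ → Set
IsDiagonal n (a , b) = a < b × b < n × ¬ IsSide n a b

Cross : ℕ × ℕ → ℕ × ℕ → Set
Cross (a , b) (c , d) = (a < c × c < b × b < d) ⊎ (c < a × a < d × d < b)

IsDissection : ℕ → List (ℕ × ℕ) → Set
IsDissection n Δ =
  Linked _<ᴾ_ Δ ×
  (∀ e → e ∈ Δ → IsDiagonal n e) ×
  (∀ e f → e ∈ Δ → f ∈ Δ → ¬ Cross e f)

Edge : ℕ → List (ℕ × ℕ) → ℕ → ℕ → Set
Edge n Δ a b = IsSide n a b ⊎ (a , b) ∈ Δ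

-- x < y are cyclically consecutive in the increasing vertex list S
ConsecIn : List ℕ → ℕ → ℕ → Set
ConsecIn S x y =
  (∀ z → z ∈ S → ¬ (x < z × z < y)) ⊎ (∀ z → z ∈ S → x ≤ z × z ≤ y)

-- S = (v₁ < … < v_k) is the vertex set of a region of the dissection Δ:
-- a polygon with k ≥ 3 vertices, whose sides are edges of the dissection,
-- and with no diagonal of Δ in its interior (i.e. joining two
-- non-consecutive vertices of S).
IsRegion : ℕ → List (ℕ × ℕ) → List ℕ → Set
IsRegion n Δ S =
  Linked _<_ S × 3 ≤ length S × (∀ v → v ∈ S → v < n) ×
  (∀ x y → x ∈ S → y ∈ S → x < y → ConsecIn S x y → Edge n Δ x y) ×
  (∀ x y → x ∈ S → y ∈ S → (x , y) ∈ Δ → ConsecIn S x y)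

IsAngulation : ℕ → ℕ → List (ℕ × ℕ) → Set
IsAngulation k n Δ = IsDissection n Δ × (∀ S → IsRegion n Δ S → length S ≡ k)

record Bijection {A B : Set} (P : A → Set) (Q : B → Set) : Set where
  field
    to       : A → B
    from     : B → A
    to-ok    : ∀ x → P x → Q (to x)
    from-ok  : ∀ y → Q y → P (from y)
    from-to  : ∀ x → P x → from (to x) ≡ x
    to-from  : ∀ y → Q y → to (from y) ≡ y

-- Both families are in bijection with full (j+1)-ary trees with m internal nodes.
--
-- A tree gives a word on an interval of values: the words of its subtrees, on consecutive
-- subintervals, followed by the j+1 values separating those subintervals in decreasing order.
-- These words avoid 312 and have pattern D^j U ⋯ U D^j, one block per internal node; conversely
-- such a word is cut at its last block, whose values split the rest into the subtrees' words.
--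
-- A tree also gives a dissection of the polygon with vertices a, …, b: the root is the region
-- containing the side (a, b), its other corners split [a, b] into one segment per subtree, and
-- each internal subtree contributes the diagonal spanning its segment. In a (j+2)-angulation the
-- region on (a, b) is found by following, from a, the farthest edge that is not (a, b); this
-- recovers the root and, recursively, the whole tree.
--
-- Both encodings are injective with exactly the required images, and the inverse of one is found
-- by searching the finite list of trees, so their composite is the bijection.

module Submission where

open import Defs
open import Data.Bool using (true; false; if_then_else_; T)
open import Data.Empty using (⊥; ⊥-elim)
import Data.Fin as F
open import Data.List
  using (List; []; _∷_; _++_; [_]; length; replicate; reverse; map; concatMap; filter; upTo; applyUpTo)
  renaming (find to first)
open import Data.List.Properties
  using (++-assoc; ++-identityʳ; length-++; length-replicate; length-reverse; map-upTo; unfold-reverse;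
         reverse-++; reverse-involutive; ∷-injective; ∷-injectiveˡ; ∷-injectiveʳ)
import Data.List.Properties as List
open import Data.List.Relation.Unary.All using (All; []; _∷_)
import Data.List.Relation.Unary.All as All
open import Data.List.Relation.Unary.Any using (here; there)
import Data.List.Relation.Unary.Any as Any
open import Data.List.Relation.Unary.Any.Properties using (reverse⁺; reverse⁻)
open import Data.List.Relation.Unary.Linked using (Linked; []; [-]; _∷_)
import Data.List.Relation.Unary.Linked as Linked
open import Data.List.Relation.Unary.Linked.Properties using () renaming (filter⁺ to linked-filter⁺)
open import Data.List.Membership.Propositional using (_∈_; find)
open import Data.List.Membership.Propositional.Properties
  using (∈-++⁺ˡ; ∈-++⁺ʳ; ∈-++⁻; ∈-filter⁺; ∈-filter⁻; ∈-map⁺; ∈-map⁻; ∈-concatMap⁺; ∈-concatMap⁻)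
open import Data.List.Relation.Binary.Permutation.Propositional
  using (_↭_; prep; swap; ↭-sym; ↭-reflexive) renaming (refl to ↭-refl; trans to ↭-trans)
open import Data.List.Relation.Binary.Permutation.Propositional.Properties
  using (∈-resp-↭; ++⁺ˡ; ++⁺; shift; ↭-reverse; ↭-length)
open import Data.Maybe using (just; fromMaybe)
open import Data.Nat using (ℕ; zero; suc; _+_; _*_; _∸_; _<_; _≤_; _>_; z≤n; s≤s; _<ᵇ_; _≟_; _<?_; _≤?_)
open import Data.Nat.Properties
open import Data.Nat.Solver using (module +-*-Solver)
open import Data.List.Membership.DecPropositional _≟_ using (_∈?_)
open import Data.Product using (Σ; _×_; _,_; proj₁; proj₂)
open import Data.Product.Properties using (,-injective) renaming (≡-dec to ×-≡-dec)
open import Data.Sum using (_⊎_; inj₁; inj₂)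
open import Data.Unit using (⊤; tt)
open import Data.Vec using (Vec; []; _∷_; lookup; toList)
open import Data.Vec.Properties using (length-toList)
import Data.Vec.Properties as Vec
open import Function using (_∘_; flip)
open import Relation.Binary.Definitions using (Transitive; DecidableEquality; tri<; tri≈; tri>)
open import Relation.Binary.PropositionalEquality
  using (_≡_; _≢_; refl; sym; trans; cong; cong₂; subst; module ≡-Reasoning)
open import Relation.Nullary using (¬_; Dec; yes; no; _×-dec_; _⊎-dec_; ¬?)
open import Relation.Unary using (Decidable)

data Subseq₂ (x y : ℕ) : List ℕ → Set where
  here₂  : ∀ {l} → y ∈ l → Subseq₂ x y (x ∷ l)
  there₂ : ∀ {w l} → Subseq₂ x y l → Subseq₂ x y (w ∷ l)

data Subseq₃ (x y z : ℕ) : List ℕ → Set where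
  here₃  : ∀ {l} → Subseq₂ y z l → Subseq₃ x y z (x ∷ l)
  there₃ : ∀ {w l} → Subseq₃ x y z l → Subseq₃ x y z (w ∷ l)

Avoids312ᴸ : List ℕ → Set
Avoids312ᴸ l = ∀ x y z → Subseq₃ x y z l → y < z → z < x → ⊥

Distinct : List ℕ → Set
Distinct l = ∀ x → Subseq₂ x x l → ⊥

Ascending Descending : List ℕ → Set
Ascending l = ∀ x y → Subseq₂ x y l → x < y
Descending l = ∀ x y → Subseq₂ x y l → y < x

subseq₂-∈ˡ : ∀ {x y l} → Subseq₂ x y l → x ∈ l
subseq₂-∈ˡ (here₂ _) = here refl
subseq₂-∈ˡ (there₂ p) = there (subseq₂-∈ˡ p)

subseq₂-∈ʳ : ∀ {x y l} → Subseq₂ x y l → y ∈ l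
subseq₂-∈ʳ (here₂ p) = there p
subseq₂-∈ʳ (there₂ p) = there (subseq₂-∈ʳ p)

subseq₃⇒subseq₂ʳ : ∀ {x y z l} → Subseq₃ x y z l → Subseq₂ y z l
subseq₃⇒subseq₂ʳ (here₃ s) = there₂ s
subseq₃⇒subseq₂ʳ (there₃ s) = there₂ (subseq₃⇒subseq₂ʳ s)

subseq₂-++⁺ˡ : ∀ {x y} l₁ {l₂} → Subseq₂ x y l₁ → Subseq₂ x y (l₁ ++ l₂)
subseq₂-++⁺ˡ (_ ∷ l₁) (here₂ p) = here₂ (∈-++⁺ˡ p)
subseq₂-++⁺ˡ (_ ∷ l₁) (there₂ p) = there₂ (subseq₂-++⁺ˡ l₁ p)

subseq₂-++⁺ʳ : ∀ {x y} l₁ {l₂} → Subseq₂ x y l₂ → Subseq₂ x y (l₁ ++ l₂)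
subseq₂-++⁺ʳ [] p = p
subseq₂-++⁺ʳ (_ ∷ l₁) p = there₂ (subseq₂-++⁺ʳ l₁ p)

subseq₂-++⁺ : ∀ {x y} l₁ {l₂} → x ∈ l₁ → y ∈ l₂ → Subseq₂ x y (l₁ ++ l₂)
subseq₂-++⁺ (_ ∷ l₁) (here refl) q = here₂ (∈-++⁺ʳ l₁ q)
subseq₂-++⁺ (_ ∷ l₁) (there p) q = there₂ (subseq₂-++⁺ l₁ p q)

subseq₂-++⁻ : ∀ {x y} l₁ {l₂} → Subseq₂ x y (l₁ ++ l₂) →
  Subseq₂ x y l₁ ⊎ (x ∈ l₁ × y ∈ l₂) ⊎ Subseq₂ x y l₂
subseq₂-++⁻ [] p = inj₂ (inj₂ p)
subseq₂-++⁻ (_ ∷ l₁) (here₂ p) with ∈-++⁻ l₁ p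
... | inj₁ q = inj₁ (here₂ q)
... | inj₂ q = inj₂ (inj₁ (here refl , q))
subseq₂-++⁻ (_ ∷ l₁) (there₂ p) with subseq₂-++⁻ l₁ p
... | inj₁ q = inj₁ (there₂ q)
... | inj₂ (inj₁ (a , b)) = inj₂ (inj₁ (there a , b))
... | inj₂ (inj₂ q) = inj₂ (inj₂ q)

subseq₃-++⁺ˡ : ∀ {x y z} l₁ {l₂} → Subseq₃ x y z l₁ → Subseq₃ x y z (l₁ ++ l₂)
subseq₃-++⁺ˡ (_ ∷ l₁) (here₃ p) = here₃ (subseq₂-++⁺ˡ l₁ p)
subseq₃-++⁺ˡ (_ ∷ l₁) (there₃ p) = there₃ (subseq₃-++⁺ˡ l₁ p)

subseq₃-++⁺ʳ : ∀ {x y z} l₁ {l₂} → Subseq₃ x y z l₂ → Subseq₃ x y z (l₁ ++ l₂)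
subseq₃-++⁺ʳ [] p = p
subseq₃-++⁺ʳ (_ ∷ l₁) p = there₃ (subseq₃-++⁺ʳ l₁ p)

subseq₃-++⁺₂₁ : ∀ {x y z} l₁ {l₂} → Subseq₂ x y l₁ → z ∈ l₂ → Subseq₃ x y z (l₁ ++ l₂)
subseq₃-++⁺₂₁ (_ ∷ l₁) (here₂ p) q = here₃ (subseq₂-++⁺ l₁ p q)
subseq₃-++⁺₂₁ (_ ∷ l₁) (there₂ p) q = there₃ (subseq₃-++⁺₂₁ l₁ p q)

subseq₃-++⁻ : ∀ {x y z} l₁ {l₂} → Subseq₃ x y z (l₁ ++ l₂) →
  Subseq₃ x y z l₁ ⊎ (x ∈ l₁ × Subseq₂ y z l₂) ⊎ (Subseq₂ x y l₁ × z ∈ l₂) ⊎ Subseq₃ x y z l₂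
subseq₃-++⁻ [] p = inj₂ (inj₂ (inj₂ p))
subseq₃-++⁻ (_ ∷ l₁) (here₃ p) with subseq₂-++⁻ l₁ p
... | inj₁ q = inj₁ (here₃ q)
... | inj₂ (inj₁ (a , b)) = inj₂ (inj₂ (inj₁ (here₂ a , b)))
... | inj₂ (inj₂ q) = inj₂ (inj₁ (here refl , q))
subseq₃-++⁻ (_ ∷ l₁) (there₃ p) with subseq₃-++⁻ l₁ p
... | inj₁ q = inj₁ (there₃ q)
... | inj₂ (inj₁ (a , b)) = inj₂ (inj₁ (there a , b))
... | inj₂ (inj₂ (inj₁ (a , b))) = inj₂ (inj₂ (inj₁ (there₂ a , b)))
... | inj₂ (inj₂ (inj₂ q)) = inj₂ (inj₂ (inj₂ q))

avoids312-++⁻ˡ : ∀ l₁ {l₂} → Avoids312ᴸ (l₁ ++ l₂) → Avoids312ᴸ l₁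
avoids312-++⁻ˡ l₁ av x y z p = av x y z (subseq₃-++⁺ˡ l₁ p)

avoids312-++⁻ʳ : ∀ l₁ {l₂} → Avoids312ᴸ (l₁ ++ l₂) → Avoids312ᴸ l₂
avoids312-++⁻ʳ l₁ av x y z p = av x y z (subseq₃-++⁺ʳ l₁ p)

avoids312-++⁺ : ∀ l₁ {l₂} → Avoids312ᴸ l₁ → Avoids312ᴸ l₂ →
  (∀ x y z → Subseq₂ x y l₁ → z ∈ l₂ → y < z → z < x → ⊥) →
  (∀ x y z → x ∈ l₁ → Subseq₂ y z l₂ → y < z → z < x → ⊥) →
  Avoids312ᴸ (l₁ ++ l₂)
avoids312-++⁺ l₁ av₁ av₂ across₂₁ across₁₂ x y z p with subseq₃-++⁻ l₁ p
... | inj₁ q = av₁ x y z q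
... | inj₂ (inj₁ (a , b)) = across₁₂ x y z a b
... | inj₂ (inj₂ (inj₁ (a , b))) = across₂₁ x y z a b
... | inj₂ (inj₂ (inj₂ q)) = av₂ x y z q

avoids312-[] : Avoids312ᴸ []
avoids312-[] x y z ()

distinct-++⁻ˡ : ∀ l₁ {l₂} → Distinct (l₁ ++ l₂) → Distinct l₁
distinct-++⁻ˡ l₁ u x p = u x (subseq₂-++⁺ˡ l₁ p)

distinct-++⁻ʳ : ∀ l₁ {l₂} → Distinct (l₁ ++ l₂) → Distinct l₂
distinct-++⁻ʳ l₁ u x p = u x (subseq₂-++⁺ʳ l₁ p)

distinct-++⇒disjoint : ∀ l₁ {l₂ x} → Distinct (l₁ ++ l₂) → x ∈ l₁ → x ∈ l₂ → ⊥
distinct-++⇒disjoint l₁ u p q = u _ (subseq₂-++⁺ l₁ p q)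

subseq₂-↭ : ∀ {x y l l′} → Subseq₂ x y l → l ↭ l′ → Subseq₂ x y l′ ⊎ Subseq₂ y x l′
subseq₂-↭ p ↭-refl = inj₁ p
subseq₂-↭ (here₂ q) (prep _ r) = inj₁ (here₂ (∈-resp-↭ r q))
subseq₂-↭ (there₂ q) (prep _ r) with subseq₂-↭ q r
... | inj₁ s = inj₁ (there₂ s)
... | inj₂ s = inj₂ (there₂ s)
subseq₂-↭ (here₂ (here refl)) (swap _ _ r) = inj₂ (here₂ (here refl))
subseq₂-↭ (here₂ (there q)) (swap _ _ r) = inj₁ (there₂ (here₂ (∈-resp-↭ r q)))
subseq₂-↭ (there₂ (here₂ q)) (swap _ _ r) = inj₁ (here₂ (there (∈-resp-↭ r q)))
subseq₂-↭ (there₂ (there₂ q)) (swap _ _ r) with subseq₂-↭ q r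
... | inj₁ s = inj₁ (there₂ (there₂ s))
... | inj₂ s = inj₂ (there₂ (there₂ s))
subseq₂-↭ p (↭-trans r₁ r₂) with subseq₂-↭ p r₁
... | inj₁ s = subseq₂-↭ s r₂
... | inj₂ s with subseq₂-↭ s r₂
...   | inj₁ t = inj₂ t
...   | inj₂ t = inj₁ t

distinct-↭ : ∀ {l l′} → l ↭ l′ → Distinct l′ → Distinct l
distinct-↭ r u x p with subseq₂-↭ p r
... | inj₁ s = u x s
... | inj₂ s = u x s

subseq₂-reverse⁻ : ∀ {x y l} → Subseq₂ x y (reverse l) → Subseq₂ y x l
subseq₂-reverse⁻ {l = []} ()
subseq₂-reverse⁻ {l = z ∷ l} p rewrite unfold-reverse z l with subseq₂-++⁻ (reverse l) p
... | inj₁ q = there₂ (subseq₂-reverse⁻ q)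
... | inj₂ (inj₁ (a , here refl)) = here₂ (reverse⁻ a)
... | inj₂ (inj₂ (here₂ ()))
... | inj₂ (inj₂ (there₂ ()))

ascending⇒reverse-descending : ∀ {l} → Ascending l → Descending (reverse l)
ascending⇒reverse-descending asc x y s = asc y x (subseq₂-reverse⁻ s)

linked-subseq₂ : ∀ {R : ℕ → ℕ → Set} → Transitive R → ∀ {x y l} → Linked R l → Subseq₂ x y l → R x y
linked-subseq₂ tr (r ∷ lk) (here₂ (here refl)) = r
linked-subseq₂ tr (r ∷ lk) (here₂ (there q)) = tr r (linked-subseq₂ tr lk (here₂ q))
linked-subseq₂ tr [-] (here₂ ())
linked-subseq₂ tr [-] (there₂ ())
linked-subseq₂ tr (r ∷ lk) (there₂ q) = linked-subseq₂ tr lk q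

no-members⇒[] : ∀ (l : List ℕ) → (∀ x → x ∈ l → ⊥) → l ≡ []
no-members⇒[] [] h = refl
no-members⇒[] (x ∷ l) h = ⊥-elim (h x (here refl))

lastOf : ℕ → List ℕ → ℕ
lastOf x [] = x
lastOf x (y ∷ ys) = lastOf y ys

lastOf-∈ : ∀ x xs → lastOf x xs ∈ (x ∷ xs)
lastOf-∈ x [] = here refl
lastOf-∈ x (y ∷ xs) = there (lastOf-∈ y xs)

∈⇒lastOf⊎precedes : ∀ {z} x xs → z ∈ (x ∷ xs) → z ≡ lastOf x xs ⊎ Subseq₂ z (lastOf x xs) (x ∷ xs)
∈⇒lastOf⊎precedes x [] (here refl) = inj₁ refl
∈⇒lastOf⊎precedes x (y ∷ xs) (here refl) = inj₂ (here₂ (lastOf-∈ y xs))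
∈⇒lastOf⊎precedes x (y ∷ xs) (there p) with ∈⇒lastOf⊎precedes y xs p
... | inj₁ e = inj₁ e
... | inj₂ s = inj₂ (there₂ s)

udStep : ℕ → ℕ → UD
udStep x y = if y <ᵇ x then D else U

udList-++ : ∀ x xs y ys →
  udList ((x ∷ xs) ++ y ∷ ys) ≡ udList (x ∷ xs) ++ udStep (lastOf x xs) y ∷ udList (y ∷ ys)
udList-++ x [] y ys = refl
udList-++ x (x′ ∷ xs) y ys = cong (udStep x x′ ∷_) (udList-++ x′ xs y ys)

length-udList : ∀ x xs → length (udList (x ∷ xs)) ≡ length xs
length-udList x [] = refl
length-udList x (y ∷ xs) = cong suc (length-udList y xs)

udStep-D⇒> : ∀ {x y} → udStep x y ≡ D → x > y
udStep-D⇒> {x} {y} e with y <ᵇ x in eq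
... | true = <ᵇ⇒< y x (subst T (sym eq) tt)
udStep-D⇒> {x} {y} () | false

udStep-U⇒≯ : ∀ {x y} → udStep x y ≡ U → ¬ x > y
udStep-U⇒≯ {x} {y} e x>y with y <ᵇ x in eq
udStep-U⇒≯ {x} {y} () x>y | true
... | false = subst T eq (<⇒<ᵇ x>y)

>⇒udStep-D : ∀ {x y} → x > y → udStep x y ≡ D
>⇒udStep-D {x} {y} x>y with y <ᵇ x in eq
... | true = refl
... | false = ⊥-elim (subst T eq (<⇒<ᵇ x>y))

≯⇒udStep-U : ∀ {x y} → ¬ x > y → udStep x y ≡ U
≯⇒udStep-U {x} {y} x≯y with y <ᵇ x in eq
... | true = ⊥-elim (x≯y (<ᵇ⇒< y x (subst T (sym eq) tt)))
... | false = refl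

descending⇒udList-D : ∀ x xs → Descending (x ∷ xs) → udList (x ∷ xs) ≡ replicate (length xs) D
descending⇒udList-D x [] h = refl
descending⇒udList-D x (y ∷ xs) h =
  cong₂ _∷_ (>⇒udStep-D (h x y (here₂ (here refl)))) (descending⇒udList-D y xs (λ a b s → h a b (there₂ s)))

udList-D⇒descending : ∀ x xs → udList (x ∷ xs) ≡ replicate (length xs) D → Descending (x ∷ xs)
udList-D⇒descending x xs e _ _ = linked-subseq₂ (flip <-trans) (linked x xs e)
  where
  linked : ∀ x xs → udList (x ∷ xs) ≡ replicate (length xs) D → Linked _>_ (x ∷ xs)
  linked x [] e = [-]
  linked x (y ∷ xs) e = udStep-D⇒> (∷-injectiveˡ e) ∷ linked y xs (∷-injectiveʳ e)

module Blocks (j : ℕ) where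

  length-blocks : ∀ r → length (blocks j (suc r)) ≡ j + suc j * r
  length-blocks zero = trans (length-replicate j) (sym (trans (cong (j +_) (*-zeroʳ j)) (+-identityʳ j)))
  length-blocks (suc r) = begin
      length (replicate j D ++ U ∷ blocks j (suc r))
    ≡⟨ length-++ (replicate j D) ⟩
      length (replicate j D) + suc (length (blocks j (suc r)))
    ≡⟨ cong₂ (λ a b → a + suc b) (length-replicate j) (length-blocks r) ⟩
      j + suc (j + suc j * r)
    ≡⟨ cong (j +_) (sym (*-suc (suc j) r)) ⟩
      j + suc j * suc r ∎
    where open ≡-Reasoning

  blocks-++ : ∀ a b → blocks j (suc a) ++ U ∷ blocks j (suc b) ≡ blocks j (suc a + suc b)
  blocks-++ zero b = refl
  blocks-++ (suc a) b = trans (++-assoc (replicate j D) (U ∷ blocks j (suc a)) (U ∷ blocks j (suc b)))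
    (cong (λ z → replicate j D ++ U ∷ z) (blocks-++ a b))

  blocks-∷ʳ : ∀ r → blocks j (suc (suc r)) ≡ blocks j (suc r) ++ U ∷ replicate j D
  blocks-∷ʳ r = sym (trans (blocks-++ r zero) (cong (λ z → blocks j (suc z)) (+-comm r 1)))

  private
    replicate-D-split : ∀ k X P Q → replicate k D ++ U ∷ X ≡ P ++ U ∷ Q →
      (P ≡ replicate k D × Q ≡ X) ⊎ Σ (List UD) (λ P′ → P ≡ replicate k D ++ U ∷ P′ × X ≡ P′ ++ U ∷ Q)
    replicate-D-split zero X [] Q refl = inj₁ (refl , refl)
    replicate-D-split zero X (U ∷ P′) Q refl = inj₂ (P′ , refl , refl)
    replicate-D-split zero X (D ∷ P′) Q ()
    replicate-D-split (suc k) X [] Q ()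
    replicate-D-split (suc k) X (U ∷ P) Q ()
    replicate-D-split (suc k) X (D ∷ P) Q e with replicate-D-split k X P Q (∷-injectiveʳ e)
    ... | inj₁ (a , b) = inj₁ (cong (D ∷_) a , b)
    ... | inj₂ (P′ , a , b) = inj₂ (P′ , cong (D ∷_) a , b)

    U∉replicate-D : ∀ k P Q → replicate k D ≢ P ++ U ∷ Q
    U∉replicate-D zero [] Q ()
    U∉replicate-D zero (_ ∷ P) Q ()
    U∉replicate-D (suc k) [] Q ()
    U∉replicate-D (suc k) (U ∷ P) Q ()
    U∉replicate-D (suc k) (D ∷ P) Q e = U∉replicate-D k P Q (∷-injectiveʳ e)

  BlockSplit : ℕ → List UD → List UD → Set
  BlockSplit r P Q = Σ ℕ λ a → Σ ℕ λ b → r ≡ suc a + suc b × P ≡ blocks j (suc a) × Q ≡ blocks j (suc b)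

  blocks-split : ∀ r P Q → blocks j r ≡ P ++ U ∷ Q → BlockSplit r P Q
  blocks-split zero [] Q ()
  blocks-split zero (_ ∷ P) Q ()
  blocks-split (suc zero) P Q e = ⊥-elim (U∉replicate-D j P Q e)
  blocks-split (suc (suc r)) P Q e =
    extend (replicate-D-split j (blocks j (suc r)) P Q e) (λ P′ → blocks-split (suc r) P′ Q)
    where
    extend : (P ≡ replicate j D × Q ≡ blocks j (suc r)) ⊎
             Σ (List UD) (λ P′ → P ≡ replicate j D ++ U ∷ P′ × blocks j (suc r) ≡ P′ ++ U ∷ Q) →
             (∀ P′ → blocks j (suc r) ≡ P′ ++ U ∷ Q → BlockSplit (suc r) P′ Q) → BlockSplit (suc (suc r)) P Q
    extend (inj₁ (eP , eQ)) _ = zero , r , refl , eP , eQ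
    extend (inj₂ (P′ , eP , e′)) split with split P′ e′
    ... | a , b , eq , eP′ , eQ = suc a , b , cong suc eq ,
        trans eP (cong (λ z → replicate j D ++ U ∷ z) eP′) , eQ

interval : ℕ → ℕ → List ℕ
interval o zero = []
interval o (suc k) = suc o ∷ interval (suc o) k

length-interval : ∀ o k → length (interval o k) ≡ k
length-interval o zero = refl
length-interval o (suc k) = cong suc (length-interval (suc o) k)

interval-++ : ∀ o a b → interval o (a + b) ≡ interval o a ++ interval (o + a) b
interval-++ o zero b = cong (λ z → interval z b) (sym (+-identityʳ o))
interval-++ o (suc a) b =
  cong (suc o ∷_) (trans (interval-++ (suc o) a b)
      (cong (λ z → interval (suc o) a ++ interval z b) (sym (+-suc o a))))

∈-interval⁻ : ∀ {x} o k → x ∈ interval o k → o < x × x ≤ o + k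
∈-interval⁻ o (suc k) (here refl) = ≤-refl , subst (suc o ≤_) (sym (+-suc o k)) (s≤s (m≤m+n o k))
∈-interval⁻ {x} o (suc k) (there p) with ∈-interval⁻ (suc o) k p
... | a , b = <-trans (n<1+n o) a , subst (x ≤_) (sym (+-suc o k)) b

∈-interval⁺ : ∀ {x} o k → o < x → x ≤ o + k → x ∈ interval o k
∈-interval⁺ {x} o zero lt le = ⊥-elim (<-irrefl refl (<-≤-trans lt (subst (x ≤_) (+-identityʳ o) le)))
∈-interval⁺ {x} o (suc k) lt le with x ≟ suc o
... | yes refl = here refl
... | no ne = there (∈-interval⁺ (suc o) k (≤∧≢⇒< lt (ne ∘ sym)) (subst (x ≤_) (+-suc o k) le))

interval-distinct : ∀ o k → Distinct (interval o k)
interval-distinct o (suc k) x (here₂ p) = <-irrefl refl (proj₁ (∈-interval⁻ (suc o) k p))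
interval-distinct o (suc k) x (there₂ p) = interval-distinct (suc o) k x p

applyUpTo≡interval : ∀ f o k → (∀ i → f i ≡ suc (o + i)) → applyUpTo f k ≡ interval o k
applyUpTo≡interval f o zero e = refl
applyUpTo≡interval f o (suc k) e =
  cong₂ _∷_ (trans (e 0) (cong suc (+-identityʳ o)))
            (applyUpTo≡interval (f ∘ suc) (suc o) k (λ i → trans (e (suc i)) (cong suc (+-suc o i))))

map-suc-upTo≡interval : ∀ N → map suc (upTo N) ≡ interval 0 N
map-suc-upTo≡interval N = trans (map-upTo suc N) (applyUpTo≡interval suc 0 N (λ i → refl))

++-injective-lengthˡ : ∀ {A : Set} (xs xs′ ys ys′ : List A) → length xs ≡ length xs′ →
  xs ++ ys ≡ xs′ ++ ys′ → xs ≡ xs′ × ys ≡ ys′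
++-injective-lengthˡ [] [] ys ys′ _ e = refl , e
++-injective-lengthˡ [] (_ ∷ _) ys ys′ () e
++-injective-lengthˡ (_ ∷ _) [] ys ys′ () e
++-injective-lengthˡ (x ∷ xs) (x′ ∷ xs′) ys ys′ l e with ∷-injective e
... | refl , e′ with ++-injective-lengthˡ xs xs′ ys ys′ (suc-injective l) e′
... | refl , e″ = refl , e″

++-injective-lengthʳ : ∀ {A : Set} (xs xs′ ys ys′ : List A) → length ys ≡ length ys′ →
  xs ++ ys ≡ xs′ ++ ys′ → xs ≡ xs′ × ys ≡ ys′
++-injective-lengthʳ xs xs′ ys ys′ l e = ++-injective-lengthˡ xs xs′ ys ys′ lx e
  where
  lx : length xs ≡ length xs′
  lx = +-cancelʳ-≡ (length ys) (length xs) (length xs′)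
    (trans (sym (length-++ xs))
        (trans (cong length e) (trans (length-++ xs′) (cong (length xs′ +_) (sym l)))))

listToVec : (n : ℕ) → List ℕ → Vec ℕ n
listToVec zero _ = []
listToVec (suc n) [] = 0 ∷ listToVec n []
listToVec (suc n) (x ∷ xs) = x ∷ listToVec n xs

toList-listToVec : ∀ n l → length l ≡ n → toList (listToVec n l) ≡ l
toList-listToVec zero [] _ = refl
toList-listToVec (suc n) (x ∷ l) e = cong (x ∷_) (toList-listToVec n l (suc-injective e))

listToVec-toList : ∀ {n} (a : Vec ℕ n) → listToVec n (toList a) ≡ a
listToVec-toList [] = refl
listToVec-toList (x ∷ a) = cong (x ∷_) (listToVec-toList a)

lookup-∈-toList : ∀ {n} (v : Vec ℕ n) i → lookup v i ∈ toList v
lookup-∈-toList (x ∷ v) F.zero = here refl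
lookup-∈-toList (x ∷ v) (F.suc i) = there (lookup-∈-toList v i)

∈-toList⇒lookup : ∀ {n} (v : Vec ℕ n) {x} → x ∈ toList v → Σ (F.Fin n) λ i → lookup v i ≡ x
∈-toList⇒lookup (y ∷ v) (here refl) = F.zero , refl
∈-toList⇒lookup (y ∷ v) (there p) with ∈-toList⇒lookup v p
... | i , e = F.suc i , e

lookup-subseq₂ : ∀ {n} (v : Vec ℕ n) i k → i F.< k → Subseq₂ (lookup v i) (lookup v k) (toList v)
lookup-subseq₂ (x ∷ v) F.zero (F.suc k) lt = here₂ (lookup-∈-toList v k)
lookup-subseq₂ (x ∷ v) (F.suc i) (F.suc k) (s≤s lt) = there₂ (lookup-subseq₂ v i k lt)

lookup-subseq₃ : ∀ {n} (v : Vec ℕ n) i k l → i F.< k → k F.< l →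
  Subseq₃ (lookup v i) (lookup v k) (lookup v l) (toList v)
lookup-subseq₃ (x ∷ v) F.zero (F.suc k) (F.suc l) _ (s≤s lt) = here₃ (lookup-subseq₂ v k l lt)
lookup-subseq₃ (x ∷ v) (F.suc i) (F.suc k) (F.suc l) (s≤s a) (s≤s b) = there₃ (lookup-subseq₃ v i k l a b)

subseq₂-lookup : ∀ {n} (v : Vec ℕ n) {x y} → Subseq₂ x y (toList v) →
  Σ (F.Fin n) λ i → Σ (F.Fin n) λ k → i F.< k × lookup v i ≡ x × lookup v k ≡ y
subseq₂-lookup (w ∷ v) (here₂ p) with ∈-toList⇒lookup v p
... | k , e = F.zero , F.suc k , s≤s z≤n , refl , e
subseq₂-lookup (w ∷ v) (there₂ p) with subseq₂-lookup v p
... | i , k , lt , e₁ , e₂ = F.suc i , F.suc k , s≤s lt , e₁ , e₂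

subseq₃-lookup : ∀ {n} (v : Vec ℕ n) {x y z} → Subseq₃ x y z (toList v) →
  Σ (F.Fin n) λ i → Σ (F.Fin n) λ k → Σ (F.Fin n) λ l →
    i F.< k × k F.< l × lookup v i ≡ x × lookup v k ≡ y × lookup v l ≡ z
subseq₃-lookup (w ∷ v) (here₃ p) with subseq₂-lookup v p
... | k , l , lt , e₁ , e₂ = F.zero , F.suc k , F.suc l , s≤s z≤n , s≤s lt , refl , e₁ , e₂
subseq₃-lookup (w ∷ v) (there₃ p) with subseq₃-lookup v p
... | i , k , l , a , b , e₁ , e₂ , e₃ = F.suc i , F.suc k , F.suc l , s≤s a , s≤s b , e₁ , e₂ , e₃

avoids312ᴸ⇒avoids312 : ∀ {n} (a : Vec ℕ n) → Avoids312ᴸ (toList a) → Avoids312 a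
avoids312ᴸ⇒avoids312 a av i k l ik kl (p , q) = av _ _ _ (lookup-subseq₃ a i k l ik kl) p q

avoids312⇒avoids312ᴸ : ∀ {n} (a : Vec ℕ n) → Avoids312 a → Avoids312ᴸ (toList a)
avoids312⇒avoids312ᴸ a av x y z s yz zx with subseq₃-lookup a s
... | i , k , l , ik , kl , refl , refl , refl = av i k l ik kl (yz , zx)

-- Full (j+1)-ary trees

data Tree : Set where
  leaf : Tree
  node : List Tree → Tree

mutual
  #internal : Tree → ℕ
  #internal leaf = 0
  #internal (node ts) = suc (#internal* ts)

  #internal* : List Tree → ℕ
  #internal* [] = 0
  #internal* (t ∷ ts) = #internal t + #internal* ts

data Full (j : ℕ) : Tree → Set where
  leaf : Full j leaf
  node : ∀ {ts} → length ts ≡ suc j → All (Full j) ts → Full j (node ts)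

FullOfSize : ℕ → ℕ → Tree → Set
FullOfSize j m t = Full j t × #internal t ≡ m

tuples : ∀ {A : Set} → List A → ℕ → List (List A)
tuples L zero = [] ∷ []
tuples L (suc k) = concatMap (λ t → map (t ∷_) (tuples L k)) L

tuples-complete : ∀ {A : Set} (L : List A) ts → All (_∈ L) ts → ts ∈ tuples L (length ts)
tuples-complete L [] [] = here refl
tuples-complete L (t ∷ ts) (p ∷ ps) = ∈-concatMap⁺ (λ u → map (u ∷_) (tuples L (length ts)))
  (Any.map (λ { refl → ∈-map⁺ (t ∷_) (tuples-complete L ts ps) }) p)

tuples-sound : ∀ {A : Set} (L : List A) k ts → ts ∈ tuples L k → length ts ≡ k × All (_∈ L) ts
tuples-sound L zero .[] (here refl) = refl , []
tuples-sound L (suc k) ts p with find (∈-concatMap⁻ (λ u → map (u ∷_) (tuples L k)) {xs = L} p)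
... | t , t∈L , q with ∈-map⁻ (t ∷_) q
... | ts′ , ts′∈ , refl with tuples-sound L k ts′ ts′∈
... | refl , al = refl , (t∈L ∷ al)

module Enumeration (j : ℕ) where

  -- full trees of height below h
  fullTrees : ℕ → List Tree
  fullTrees zero = []
  fullTrees (suc h) = leaf ∷ map node (tuples (fullTrees h) (suc j))

  fullTrees-full : ∀ h t → t ∈ fullTrees h → Full j t
  fullTrees-full (suc h) .leaf (here refl) = leaf
  fullTrees-full (suc h) t (there p) with ∈-map⁻ node p
  ... | ts , ts∈ , refl with tuples-sound (fullTrees h) (suc j) ts ts∈
  ... | len , al = node len (All.map (fullTrees-full h _) al)

  mutual
    fullTrees-complete : ∀ t h → Full j t → #internal t < h → t ∈ fullTrees h
    fullTrees-complete leaf (suc h) leaf _ = here refl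
    fullTrees-complete (node ts) (suc h) (node len al) (s≤s lt) =
      there (∈-map⁺ node (subst (λ k → ts ∈ tuples (fullTrees h) k) len
        (tuples-complete (fullTrees h) ts (fullTrees-complete* ts h al lt))))

    fullTrees-complete* : ∀ ts h → All (Full j) ts → #internal* ts < h → All (_∈ fullTrees h) ts
    fullTrees-complete* [] h [] _ = []
    fullTrees-complete* (t ∷ ts) h (v ∷ vs) lt =
      fullTrees-complete t h v (≤-trans (s≤s (m≤m+n (#internal t) (#internal* ts))) lt)
      ∷ fullTrees-complete* ts h vs (≤-trans (s≤s (m≤n+m (#internal* ts) (#internal t))) lt)

  treesOfSize : ℕ → List Tree
  treesOfSize m = filter (λ t → #internal t ≟ m) (fullTrees (suc m))

  treesOfSize-complete : ∀ m t → FullOfSize j m t → t ∈ treesOfSize m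
  treesOfSize-complete m t (full , size) =
    ∈-filter⁺ (λ t → #internal t ≟ m) (fullTrees-complete t (suc m) full (s≤s (≤-reflexive size))) size

  treesOfSize-sound : ∀ m t → t ∈ treesOfSize m → FullOfSize j m t
  treesOfSize-sound m t p with ∈-filter⁻ (λ t → #internal t ≟ m) {xs = fullTrees (suc m)} p
  ... | t∈ , size = fullTrees-full (suc m) t t∈ , size

-- Bijections through a common set of codes

record Coding {C A : Set} (G : C → Set) (P : A → Set) (code : C → A) : Set where
  field
    sound      : ∀ c → G c → P (code c)
    injective  : ∀ c c′ → G c → G c′ → code c ≡ code c′ → c ≡ c′
    surjective : ∀ a → P a → Σ C λ c → G c × code c ≡ a

first-complete : ∀ {A : Set} {P : A → Set} (P? : Decidable P) {x} xs → x ∈ xs → P x →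
  Σ A λ y → first P? xs ≡ just y × y ∈ xs × P y
first-complete P? (y ∷ xs) p px with P? y
... | yes py = y , refl , here refl , py
... | no ¬py with p
...   | here refl = ⊥-elim (¬py px)
...   | there q with first-complete P? xs q px
...     | z , e , z∈ , pz = z , e , there z∈ , pz

module ViaCodes {C : Set} {G : C → Set} (cs : List C) (c₀ : C)
                (cs-complete : ∀ c → G c → c ∈ cs) (cs-sound : ∀ c → c ∈ cs → G c) where

  decodeWith : {A : Set} → DecidableEquality A → (C → A) → A → C
  decodeWith _≟ᴬ_ code a = fromMaybe c₀ (first (λ c → code c ≟ᴬ a) cs)

  decodeWith-spec : ∀ {A : Set} {P : A → Set} {code : C → A} (_≟ᴬ_ : DecidableEquality A) → Coding G P code →
    ∀ a → P a → G (decodeWith _≟ᴬ_ code a) × code (decodeWith _≟ᴬ_ code a) ≡ a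
  decodeWith-spec {code = code} _≟ᴬ_ coding a pa with Coding.surjective coding a pa
  ... | c , gc , e with first-complete (λ c → code c ≟ᴬ a) cs (cs-complete c gc) e
  ...   | c′ , found , c′∈ , e′ rewrite found = cs-sound c′ c′∈ , e′

  round-trip : ∀ {A B : Set} {P : A → Set} {Q : B → Set} {f : C → A} {g : C → B}
    (_≟ᴬ_ : DecidableEquality A) (_≟ᴮ_ : DecidableEquality B) → Coding G P f → Coding G Q g →
    ∀ a → P a → f (decodeWith _≟ᴮ_ g (g (decodeWith _≟ᴬ_ f a))) ≡ a
  round-trip {f = f} _≟ᴬ_ _≟ᴮ_ F H a pa with decodeWith-spec _≟ᴬ_ F a pa
  ... | good , f≡a with decodeWith-spec _≟ᴮ_ H _ (Coding.sound H _ good)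
  ...   | good′ , g≡g = trans (cong f (Coding.injective H _ _ good′ good g≡g)) f≡a

  bijection : ∀ {A B : Set} {P : A → Set} {Q : B → Set} {f : C → A} {g : C → B} →
    DecidableEquality A → DecidableEquality B → Coding G P f → Coding G Q g → Bijection P Q
  bijection {f = f} {g} _≟ᴬ_ _≟ᴮ_ F H = record
    { to = λ a → g (decodeWith _≟ᴬ_ f a)
    ; from = λ b → f (decodeWith _≟ᴮ_ g b)
    ; to-ok = λ a pa → Coding.sound H _ (proj₁ (decodeWith-spec _≟ᴬ_ F a pa))
    ; from-ok = λ b qb → Coding.sound F _ (proj₁ (decodeWith-spec _≟ᴮ_ H b qb))
    ; from-to = round-trip _≟ᴬ_ _≟ᴮ_ F H
    ; to-from = round-trip _≟ᴮ_ _≟ᴬ_ H F }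

-- Permutations from trees

module PermutationCode (j : ℕ) where
  open Blocks j

  mutual
    #edges : Tree → ℕ
    #edges leaf = 0
    #edges (node ds) = #edges* ds
    #edges* : List Tree → ℕ
    #edges* [] = 0
    #edges* (d ∷ ds) = #edges d + suc (#edges* ds)

  rootLabels : List Tree → ℕ → List ℕ
  rootLabels [] o = []
  rootLabels (d ∷ ds) o = suc (o + #edges d) ∷ rootLabels ds (suc (o + #edges d))

  mutual
    treeWord : Tree → ℕ → List ℕ
    treeWord leaf o = []
    treeWord (node ds) o = forestWord ds o ++ reverse (rootLabels ds o)
    forestWord : List Tree → ℕ → List ℕ
    forestWord [] o = []
    forestWord (d ∷ ds) o = treeWord d o ++ forestWord ds (suc (o + #edges d))

  mutual
    treeWord-↭ : ∀ t o → treeWord t o ↭ interval o (#edges t)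
    treeWord-↭ leaf o = ↭-refl
    treeWord-↭ (node ds) o = ↭-trans (++⁺ˡ (forestWord ds o) (↭-reverse (rootLabels ds o)))
        (forestWord-↭ ds o)

    forestWord-↭ : ∀ ds o → forestWord ds o ++ rootLabels ds o ↭ interval o (#edges* ds)
    forestWord-↭ [] o = ↭-refl
    forestWord-↭ (d ∷ ds) o =
      ↭-trans (↭-reflexive (++-assoc (treeWord d o) (forestWord ds u) (u ∷ rootLabels ds u)))
      (↭-trans (++⁺ˡ (treeWord d o) (shift u (forestWord ds u) (rootLabels ds u)))
      (↭-trans (++⁺ (treeWord-↭ d o) (prep u (forestWord-↭ ds u)))
      (↭-reflexive (sym (interval-++ o (#edges d) (suc (#edges* ds)))))))
      where
      u : ℕ
      u = suc (o + #edges d)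

  length-treeWord : ∀ t o → length (treeWord t o) ≡ #edges t
  length-treeWord t o = trans (↭-length (treeWord-↭ t o)) (length-interval o (#edges t))

  ∈-treeWord⁻ : ∀ {x} t o → x ∈ treeWord t o → o < x × x ≤ o + #edges t
  ∈-treeWord⁻ t o p = ∈-interval⁻ o (#edges t) (∈-resp-↭ (treeWord-↭ t o) p)

  ∈-treeWord⁺ : ∀ {x} t o → o < x → x ≤ o + #edges t → x ∈ treeWord t o
  ∈-treeWord⁺ t o a b = ∈-resp-↭ (↭-sym (treeWord-↭ t o)) (∈-interval⁺ o (#edges t) a b)

  ∈-forestWord++rootLabels⁻ : ∀ {x} ds o → x ∈ forestWord ds o ++ rootLabels ds o → o < x × x ≤ o + #edges* ds
  ∈-forestWord++rootLabels⁻ ds o p = ∈-interval⁻ o (#edges* ds) (∈-resp-↭ (forestWord-↭ ds o) p)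

  ∈-forestWord⁻ : ∀ {x} ds o → x ∈ forestWord ds o → o < x × x ≤ o + #edges* ds
  ∈-forestWord⁻ ds o p = ∈-forestWord++rootLabels⁻ ds o (∈-++⁺ˡ p)

  ∈-rootLabels⁻ : ∀ {x} ds o → x ∈ rootLabels ds o → o < x × x ≤ o + #edges* ds
  ∈-rootLabels⁻ ds o p = ∈-forestWord++rootLabels⁻ ds o (∈-++⁺ʳ (forestWord ds o) p)

  forestWord++rootLabels-distinct : ∀ ds o → Distinct (forestWord ds o ++ rootLabels ds o)
  forestWord++rootLabels-distinct ds o = distinct-↭ (forestWord-↭ ds o) (interval-distinct o (#edges* ds))

  rootLabels-ascending : ∀ ds o → Ascending (rootLabels ds o)
  rootLabels-ascending (d ∷ ds) o _ _ (here₂ p) = proj₁ (∈-rootLabels⁻ ds _ p)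
  rootLabels-ascending (d ∷ ds) o x y (there₂ p) = rootLabels-ascending ds _ x y p

  length-rootLabels : ∀ ds o → length (rootLabels ds o) ≡ length ds
  length-rootLabels [] o = refl
  length-rootLabels (d ∷ ds) o = cong suc (length-rootLabels ds _)

  rootLabels-last : ∀ d ds o → Σ (List ℕ) λ M' → rootLabels (d ∷ ds) o ≡ M' ++ [ o + #edges* (d ∷ ds) ]
  rootLabels-last d [] o = [] ,
      cong [_] (sym (trans (cong (o +_) (+-suc (#edges d) 0))
      (trans (+-suc o (#edges d + 0)) (cong (λ z → suc (o + z)) (+-identityʳ (#edges d))))))
  rootLabels-last d (d' ∷ ds) o with rootLabels-last d' ds (suc (o + #edges d))
  ... | M' , e = (suc (o + #edges d) ∷ M') ,
      cong (suc (o + #edges d) ∷_) (trans e (cong (λ z → M' ++ [ z ]) eq))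
    where
    eq : suc (o + #edges d) + #edges* (d' ∷ ds) ≡ o + (#edges d + suc (#edges* (d' ∷ ds)))
    eq = sym (trans (cong (o +_) (+-suc (#edges d) _))
        (trans (+-suc o _) (cong suc (sym (+-assoc o (#edges d) _)))))

  ∈-treeWord⇒< : ∀ {x} d o → x ∈ treeWord d o → x < suc (o + #edges d)
  ∈-treeWord⇒< d o p = s≤s (proj₂ (∈-treeWord⁻ d o p))

  mutual
    treeWord-avoids312 : ∀ t o → Avoids312ᴸ (treeWord t o)
    treeWord-avoids312 leaf o = avoids312-[]
    treeWord-avoids312 (node ds) o = avoids312-++⁺ (forestWord ds o)
        (forestWord-avoids312 ds o) labels-avoid312 across₂₁ across₁₂
      where
      labels-avoid312 : Avoids312ᴸ (reverse (rootLabels ds o))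
      labels-avoid312 x y z s y<z z<x = <-asym y<z
          (rootLabels-ascending ds o _ _ (subseq₂-reverse⁻ (subseq₃⇒subseq₂ʳ s)))
      across₂₁ : ∀ x y z → Subseq₂ x y (forestWord ds o) → z ∈ reverse (rootLabels ds o) → y < z → z < x → ⊥
      across₂₁ x y z s p y<z z<x = forestWord-rootLabels-no312 ds o x y s z (reverse⁻ p) y<z z<x
      across₁₂ : ∀ x y z → x ∈ forestWord ds o → Subseq₂ y z (reverse (rootLabels ds o)) → y < z → z < x → ⊥
      across₁₂ x y z _ s y<z _ = <-asym y<z (rootLabels-ascending ds o _ _ (subseq₂-reverse⁻ s))

    forestWord-avoids312 : ∀ ds o → Avoids312ᴸ (forestWord ds o)
    forestWord-avoids312 [] o = avoids312-[]
    forestWord-avoids312 (d ∷ ds) o = avoids312-++⁺ (treeWord d o) (treeWord-avoids312 d o)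
        (forestWord-avoids312 ds u) across₂₁ across₁₂
      where
      u : ℕ
      u = suc (o + #edges d)
      across₂₁ : ∀ x y z → Subseq₂ x y (treeWord d o) → z ∈ forestWord ds u → y < z → z < x → ⊥
      across₂₁ x y z s p y<z z<x = <-asym z<x
          (<-trans (∈-treeWord⇒< d o (subseq₂-∈ˡ s)) (proj₁ (∈-forestWord⁻ ds u p)))
      across₁₂ : ∀ x y z → x ∈ treeWord d o → Subseq₂ y z (forestWord ds u) → y < z → z < x → ⊥
      across₁₂ x y z p s y<z z<x = <-asym (<-trans y<z z<x)
          (<-trans (∈-treeWord⇒< d o p) (proj₁ (∈-forestWord⁻ ds u (subseq₂-∈ˡ s))))

    forestWord-rootLabels-no312 : ∀ ds o x y → Subseq₂ x y (forestWord ds o) → ∀ z → z ∈ rootLabels ds o →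
      y < z → z < x → ⊥
    forestWord-rootLabels-no312 (d ∷ ds) o x y s z zm y<z z<x with subseq₂-++⁻ (treeWord d o) s
    ... | inj₁ s' = <-asym z<x (<-≤-trans (∈-treeWord⇒< d o (subseq₂-∈ˡ s')) (u≤z zm))
      where
      u≤z : z ∈ rootLabels (d ∷ ds) o → suc (o + #edges d) ≤ z
      u≤z (here refl) = ≤-refl
      u≤z (there q) = <⇒≤ (proj₁ (∈-rootLabels⁻ ds _ q))
    ... | inj₂ (inj₁ (xm , ym)) = <-asym (<-trans y<z z<x)
        (<-trans (∈-treeWord⇒< d o xm) (proj₁ (∈-forestWord⁻ ds _ ym)))
    ... | inj₂ (inj₂ s') with zm
    ...   | here refl = <-asym y<z (proj₁ (∈-forestWord⁻ ds _ (subseq₂-∈ʳ s')))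
    ...   | there q = forestWord-rootLabels-no312 ds _ x y s' z q y<z z<x

  HasBlocks : List ℕ → ℕ → Set
  HasBlocks l r = udList l ≡ blocks j r × length l ≡ suc j * r

  hasBlocks-[] : HasBlocks [] 0
  hasBlocks-[] = refl , sym (*-zeroʳ (suc j))

  hasBlocks-0⇒[] : ∀ {l} → HasBlocks l 0 → l ≡ []
  hasBlocks-0⇒[] {[]} _ = refl
  hasBlocks-0⇒[] {x ∷ l} (_ , e) = ⊥-elim (1+n≢0 (trans e (*-zeroʳ (suc j))))

  hasBlocks-++ : ∀ l1 l2 r1 r2 → HasBlocks l1 r1 → HasBlocks l2 r2 →
    (∀ x y ys → x ∈ l1 → l2 ≡ y ∷ ys → x < y) → HasBlocks (l1 ++ l2) (r1 + r2)
  hasBlocks-++ l1 l2 zero r2 p1 p2 h rewrite hasBlocks-0⇒[] p1 = p2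
  hasBlocks-++ [] l2 (suc a) r2 (_ , ()) p2 h
  hasBlocks-++ (x ∷ xs) l2 (suc a) zero p1 p2 h rewrite hasBlocks-0⇒[] p2 | ++-identityʳ
      xs | +-identityʳ a = p1
  hasBlocks-++ (x ∷ xs) [] (suc a) (suc b) p1 (_ , ()) h
  hasBlocks-++ (x ∷ xs) (y ∷ ys) (suc a) (suc b) (u1 , l1) (u2 , l2) h =
    trans (udList-++ x xs y ys)
        (trans (cong₂ (λ p q → p ++ q) u1
        (cong₂ _∷_ (≯⇒udStep-U (<-asym (h _ y ys (lastOf-∈ x xs) refl))) u2)) (blocks-++ a b)) ,
    trans (length-++ (x ∷ xs)) (trans (cong₂ _+_ l1 l2) (sym (*-distribˡ-+ (suc j) (suc a) (suc b))))

  descending-hasBlock : ∀ l → Descending l → length l ≡ suc j → HasBlocks l 1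
  descending-hasBlock (x ∷ xs) desc len =
    trans (descending⇒udList-D x xs desc) (cong (λ k → replicate k D) (suc-injective len)) ,
    trans len (sym (*-identityʳ (suc j)))

  reverse-rootLabels : ∀ d ds o → Σ (List ℕ) λ L →
    reverse (rootLabels (d ∷ ds) o) ≡ (o + #edges* (d ∷ ds)) ∷ L
  reverse-rootLabels d ds o with rootLabels-last d ds o
  ... | L , e = reverse L , trans (cong reverse e) (reverse-++ L [ o + #edges* (d ∷ ds) ])

  mutual
    treeWord-hasBlocks : ∀ t o → Full j t → HasBlocks (treeWord t o) (#internal t)
    treeWord-hasBlocks leaf o leaf = hasBlocks-[]
    treeWord-hasBlocks (node []) o (node () _)
    treeWord-hasBlocks (node ts@(d ∷ ds)) o (node len fulls) =
      subst (HasBlocks (treeWord (node ts) o)) (+-comm (#internal* ts) 1)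
        (hasBlocks-++ (forestWord ts o) (reverse (rootLabels ts o)) (#internal* ts) 1
            (forestWord-hasBlocks ts o fulls)
          (descending-hasBlock (reverse (rootLabels ts o))
              (ascending⇒reverse-descending (rootLabels-ascending ts o))
            (trans (length-reverse (rootLabels ts o)) (trans (length-rootLabels ts o) len)))
          ascent)
      where
      ascent : ∀ x y ys → x ∈ forestWord ts o → reverse (rootLabels ts o) ≡ y ∷ ys → x < y
      ascent x y ys p e with reverse-rootLabels d ds o
      ... | L , eL with trans (sym e) eL
      ... | refl = ≤∧≢⇒< (proj₂ (∈-forestWord⁻ ts o p))
        (λ { refl → distinct-++⇒disjoint (forestWord ts o) (forestWord++rootLabels-distinct ts o) p
                      (reverse⁻ (subst (o + #edges* ts ∈_) (sym e) (here refl))) })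

    forestWord-hasBlocks : ∀ ds o → All (Full j) ds → HasBlocks (forestWord ds o) (#internal* ds)
    forestWord-hasBlocks [] o [] = hasBlocks-[]
    forestWord-hasBlocks (d ∷ ds) o (v ∷ vs) = hasBlocks-++ (treeWord d o) (forestWord ds _) (#internal d)
        (#internal* ds) (treeWord-hasBlocks d o v) (forestWord-hasBlocks ds _ vs)
      (λ x y ys p e → <-trans (∈-treeWord⇒< d o p)
          (proj₁ (∈-forestWord⁻ ds _ (subst (y ∈_) (sym e) (here refl)))))

  treeWord-node-nonempty : ∀ ds o → Full j (node ds) → 0 < length (treeWord (node ds) o)
  treeWord-node-nonempty ds o (node len al) rewrite length-++
      (forestWord ds o) {reverse (rootLabels ds o)} | length-reverse
      (rootLabels ds o) | length-rootLabels ds o | len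
    = subst (0 <_) (sym (+-suc (length (forestWord ds o)) j)) (s≤s z≤n)

  mutual
    treeWord-injective : ∀ t t' o → Full j t → Full j t' → treeWord t o ≡ treeWord t' o → t ≡ t'
    treeWord-injective leaf leaf o _ _ e = refl
    treeWord-injective leaf (node ds') o _ v' e = ⊥-elim
        (<-irrefl refl (subst (λ l → 0 < length l) (sym e) (treeWord-node-nonempty ds' o v')))
    treeWord-injective (node ds) leaf o v _ e = ⊥-elim
        (<-irrefl refl (subst (λ l → 0 < length l) e (treeWord-node-nonempty ds o v)))
    treeWord-injective (node ds) (node ds') o (node len al) (node len' al') e with ++-injective-lengthʳ
        (forestWord ds o) (forestWord ds' o) (reverse (rootLabels ds o)) (reverse (rootLabels ds' o))
         (trans (length-reverse (rootLabels ds o))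
             (trans (length-rootLabels ds o)
             (trans len (sym (trans (length-reverse (rootLabels ds' o))
             (trans (length-rootLabels ds' o) len')))))) e
    ... | eb , em = cong node
        (forestWord-injective ds ds' o al al' eb
        (trans (sym (reverse-involutive (rootLabels ds o)))
        (trans (cong reverse em) (reverse-involutive (rootLabels ds' o)))))

    forestWord-injective : ∀ ds ds' o → All (Full j) ds → All (Full j) ds' →
      forestWord ds o ≡ forestWord ds' o → rootLabels ds o ≡ rootLabels ds' o → ds ≡ ds'
    forestWord-injective [] [] o _ _ _ _ = refl
    forestWord-injective [] (_ ∷ _) o _ _ _ ()
    forestWord-injective (_ ∷ _) [] o _ _ _ ()
    forestWord-injective (d ∷ ds) (d' ∷ ds') o (v ∷ vs) (v' ∷ vs') eb em with ∷-injective em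
    ... | eu , em' with +-cancelˡ-≡ o (#edges d) (#edges d') (suc-injective eu)
    ... | ev with ++-injective-lengthˡ (treeWord d o) (treeWord d' o) (forestWord ds (suc (o + #edges d)))
        (forestWord ds' (suc (o + #edges d')))
                   (trans (length-treeWord d o) (trans ev (sym (length-treeWord d' o)))) eb
    ... | e1 , e2 rewrite ev = cong₂ _∷_ (treeWord-injective d d' o v v' e1)
        (forestWord-injective ds ds' _ vs vs' e2 em')

  record Decodable (o c r : ℕ) (l : List ℕ) : Set where
    constructor decodable
    field
      distinct  : Distinct l
      bounded   : ∀ x → x ∈ l → o < x × x < c
      complete  : ∀ x → o < x → x < c → x ∈ l
      avoids312 : Avoids312ᴸ l
      hasBlocks : HasBlocks l r

  record DecodableForest (us : List ℕ) (o : ℕ) (w : List ℕ) (r : ℕ) : Set where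
    field
      labels-ascending : Ascending us
      labels-above     : ∀ u → u ∈ us → o < u
      distinct         : Distinct w
      above            : ∀ x → x ∈ w → o < x
      disjoint         : ∀ x → x ∈ w → x ∈ us → ⊥
      below-label      : ∀ x → x ∈ w → Σ ℕ λ u → u ∈ us × x < u
      complete         : ∀ x u → o < x → u ∈ us → x < u → (x ∈ us → ⊥) → x ∈ w
      avoids312        : Avoids312ᴸ w
      no312-label      : ∀ x y → Subseq₂ x y w → ∀ u → u ∈ us → y < u → u < x → ⊥
      hasBlocks        : HasBlocks w r

  TreeDecoding : ℕ → ℕ → List ℕ → Set
  TreeDecoding o r l = Σ Tree λ t → Full j t × #internal t ≡ r × treeWord t o ≡ l

  ForestDecoding : List ℕ → ℕ → List ℕ → ℕ → Set
  ForestDecoding us o w r = Σ (List Tree) λ ts →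
    All (Full j) ts × length ts ≡ length us × #internal* ts ≡ r × forestWord ts o ≡ w × rootLabels ts o ≡ us

  hasBlocks-[]⇒0 : ∀ {r} → HasBlocks [] r → r ≡ 0
  hasBlocks-[]⇒0 {zero} _ = refl
  hasBlocks-[]⇒0 {suc r} (_ , ())

  udList-blocks⇒length : ∀ x xs a → udList (x ∷ xs) ≡ blocks j (suc a) → length (x ∷ xs) ≡ suc j * suc a
  udList-blocks⇒length x xs a e =
    trans (cong suc (trans (sym (length-udList x xs)) (trans (cong length e) (length-blocks a))))
        (sym (*-suc (suc j) a))

  record BlocksSplit (B R : List ℕ) (r : ℕ) : Set where
    field
      r₁ r₂    : ℕ
      sum      : r₁ + r₂ ≡ r
      blocks₁  : HasBlocks B r₁
      blocks₂  : HasBlocks R r₂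

  -- The ascent from B to R can only sit between two blocks.
  hasBlocks-split : ∀ u B R r → HasBlocks (B ++ R) r → (∀ x → x ∈ B → x < u) → (∀ y → y ∈ R → u < y) →
    BlocksSplit B R r
  hasBlocks-split u [] R r p _ _ = record
      { r₁ = 0 ; r₂ = r ; sum = refl ; blocks₁ = hasBlocks-[] ; blocks₂ = p }
  hasBlocks-split u (b ∷ B) [] r p _ _ =
    record { r₁ = r ; r₂ = 0 ; sum = +-identityʳ r ; blocks₁ = subst (λ l → HasBlocks l r)
        (++-identityʳ (b ∷ B)) p
           ; blocks₂ = hasBlocks-[] }
  hasBlocks-split u (b ∷ B) (h ∷ R) r (ud , _) below above
    with blocks-split r (udList (b ∷ B)) (udList (h ∷ R)) udr′
    where
    ascent : ¬ lastOf b B > h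
    ascent h<l = <-asym h<l (<-trans (below _ (lastOf-∈ b B)) (above h (here refl)))
    udr′ : blocks j r ≡ udList (b ∷ B) ++ U ∷ udList (h ∷ R)
    udr′ = sym (trans (cong (λ z → udList (b ∷ B) ++ z ∷ udList (h ∷ R)) (sym (≯⇒udStep-U ascent)))
                          (trans (sym (udList-++ b B h R)) ud))
  ... | a , c , eq , e₁ , e₂ =
    record { r₁ = suc a ; r₂ = suc c ; sum = sym eq
           ; blocks₁ = e₁ , udList-blocks⇒length b B a e₁ ; blocks₂ = e₂ , udList-blocks⇒length h R c e₂ }

  splitAtLength : ∀ k (l : List ℕ) → k ≤ length l → Σ (List ℕ) λ pre → Σ (List ℕ) λ M →
    l ≡ pre ++ M × length pre ≡ k
  splitAtLength zero l _ = [] , l , refl , refl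
  splitAtLength (suc k) (x ∷ l) (s≤s le) with splitAtLength k l le
  ... | pre , M , e , lp = x ∷ pre , M , cong (x ∷_) e , cong suc lp

  private
    lastBlock-shape : ∀ r pre top rest → length pre ≡ suc j * r → length rest ≡ j →
      udList (pre ++ top ∷ rest) ≡ blocks j (suc r) →
      HasBlocks pre r × Descending (top ∷ rest) × (∀ p ps → pre ≡ p ∷ ps → ¬ lastOf p ps > top)
    lastBlock-shape zero [] top rest _ len-rest ud =
      hasBlocks-[] , udList-D⇒descending top rest (trans ud (cong (λ k → replicate k D) (sym len-rest))) ,
          (λ _ _ ())
    lastBlock-shape (suc r) [] top rest () len-rest ud
    lastBlock-shape zero (p ∷ ps) top rest len _ _ = ⊥-elim (1+n≢0 (trans len (*-zeroʳ (suc j))))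
    lastBlock-shape (suc r) (p ∷ ps) top rest len len-rest ud
      with ++-injective-lengthʳ (udList (p ∷ ps)) (blocks j (suc r))
             (udStep (lastOf p ps) top ∷ udList (top ∷ rest)) (U ∷ replicate j D)
             (cong suc (trans (length-udList top rest) (trans len-rest (sym (length-replicate j)))))
             (trans (sym (udList-++ p ps top rest)) (trans ud (blocks-∷ʳ r)))
    ... | e₁ , e₂ =
      (e₁ , len) ,
      udList-D⇒descending top rest (trans (∷-injectiveʳ e₂) (cong (λ k → replicate k D) (sym len-rest))) ,
      (λ { _ _ refl → udStep-U⇒≯ (∷-injectiveˡ e₂) })

  record LastBlock (r : ℕ) (l : List ℕ) : Set where
    constructor lastBlock
    field
      prefix      : List ℕ
      top         : ℕ
      rest        : List ℕ
      split       : l ≡ prefix ++ top ∷ rest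
      length-rest : length rest ≡ j
      prefix-blocks : HasBlocks prefix r
      descending  : Descending (top ∷ rest)
      ascent      : ∀ p ps → prefix ≡ p ∷ ps → ¬ lastOf p ps > top

  splitLastBlock : ∀ r l → HasBlocks l (suc r) → LastBlock r l
  splitLastBlock r l (ud , len)
    with splitAtLength (suc j * r) l (subst (suc j * r ≤_) (sym len) (*-monoʳ-≤ (suc j) (n≤1+n r)))
  ... | pre , M , refl , lp = fromLength M
      (+-cancelˡ-≡ (suc j * r) _ _ (trans (cong (_+ length M) (sym lp)) len′)) ud
    where
    len′ : length pre + length M ≡ suc j * r + suc j
    len′ = trans (sym (length-++ pre)) (trans len (trans (*-suc (suc j) r) (+-comm (suc j) _)))
    fromLength : ∀ M → length M ≡ suc j → udList (pre ++ M) ≡ blocks j (suc r) → LastBlock r (pre ++ M)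
    fromLength (top ∷ rest) lenM udM with lastBlock-shape r pre top rest lp (suc-injective lenM) udM
    ... | blocks , desc , asc = lastBlock pre top rest refl (suc-injective lenM) blocks desc asc

  decodable⇒decodableForest : ∀ {o c r pre top rest} → Decodable o c (suc r) (pre ++ top ∷ rest) →
    HasBlocks pre r → Descending (top ∷ rest) → (∀ p ps → pre ≡ p ∷ ps → ¬ lastOf p ps > top) →
    DecodableForest (reverse (top ∷ rest)) o pre r
  decodable⇒decodableForest {o} {c} {r} {pre} {top} {rest}
      (decodable uq bd cp av _) pre-blocks desc asc = record
    { labels-ascending = λ a b s → desc b a (subseq₂-reverse⁻ s)
    ; labels-above = λ u p → proj₁ (bd u (∈-++⁺ʳ pre (reverse⁻ p)))
    ; distinct = distinct-++⁻ˡ pre uq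
    ; above = λ x p → proj₁ (bd x (∈-++⁺ˡ p))
    ; disjoint = λ x p q → disj p (reverse⁻ q)
    ; below-label = λ x p → top , reverse⁺ {xs = top ∷ rest} (here refl) , below-top pre refl x p
    ; complete = complete
    ; avoids312 = avoids312-++⁻ˡ pre av
    ; no312-label = λ x y s u um yu ux → av x y u (subseq₃-++⁺₂₁ pre s (reverse⁻ um)) yu ux
    ; hasBlocks = pre-blocks }
    where
    disj : ∀ {x} → x ∈ pre → x ∈ top ∷ rest → ⊥
    disj = distinct-++⇒disjoint pre uq
    -- 312-avoidance pushes every letter of the prefix below its last one, which is below top.
    below-top : ∀ ps → ps ≡ pre → ∀ x → x ∈ ps → x < top
    below-top (p ∷ ps) e x xm with ∈⇒lastOf⊎precedes p ps xm
    ... | inj₁ refl = last<top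
      where
      last<top : lastOf p ps < top
      last<top = ≤∧≢⇒< (≮⇒≥ (asc p ps (sym e)))
        (λ e′ → disj (subst (lastOf p ps ∈_) e (lastOf-∈ p ps)) (subst (_∈ top ∷ rest) (sym e′) (here refl)))
    ... | inj₂ s with <-cmp x top
    ...   | tri< lt _ _ = lt
    ...   | tri≈ _ eq _ = ⊥-elim (disj (subst (x ∈_) e xm) (here eq))
    ...   | tri> _ _ gt =
      ⊥-elim (av x (lastOf p ps) top
          (subseq₃-++⁺₂₁ pre (subst (Subseq₂ x (lastOf p ps)) e s) (here refl)) last<top gt)
      where
      last<top : lastOf p ps < top
      last<top = ≤∧≢⇒< (≮⇒≥ (asc p ps (sym e)))
        (λ e′ → disj (subst (lastOf p ps ∈_) e (lastOf-∈ p ps)) (subst (_∈ top ∷ rest) (sym e′) (here refl)))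
    complete : ∀ x u → o < x → u ∈ reverse (top ∷ rest) → x < u → (x ∈ reverse (top ∷ rest) → ⊥) → x ∈ pre
    complete x u ox um xu nx with ∈-++⁻ pre (cp x ox (<-trans xu (proj₂ (bd u (∈-++⁺ʳ pre (reverse⁻ um))))))
    ... | inj₁ q = q
    ... | inj₂ q = ⊥-elim (nx (reverse⁺ q))

  spanBelow : ∀ u (l : List ℕ) → Σ (List ℕ) λ B → Σ (List ℕ) λ R →
    l ≡ B ++ R × (∀ x → x ∈ B → x < u) × (∀ y ys → R ≡ y ∷ ys → ¬ y < u)
  spanBelow u [] = [] , [] , refl , (λ _ ()) , (λ _ _ ())
  spanBelow u (x ∷ l) with x <? u
  ... | no x≮u = [] , x ∷ l , refl , (λ _ ()) , (λ { y ys refl → x≮u })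
  ... | yes x<u with spanBelow u l
  ...   | B , R , e , below , notBelow =
    x ∷ B , R , cong (x ∷_) e , (λ { z (here refl) → x<u ; z (there q) → below z q }) , notBelow

  rest-above : ∀ u B R → (∀ x → x ∈ B ++ R → x ≡ u → ⊥) → (∀ x y → Subseq₂ x y (B ++ R) → y < u → u < x → ⊥) →
    (∀ y ys → R ≡ y ∷ ys → ¬ y < u) → ∀ y → y ∈ R → u < y
  rest-above u B (h ∷ R) ≢u no312 notBelow = above
    where
    u<h : u < h
    u<h = ≤∧≢⇒< (≮⇒≥ (notBelow h R refl)) (λ e → ≢u h (∈-++⁺ʳ B (here refl)) (sym e))
    above : ∀ y → y ∈ h ∷ R → u < y
    above y (here refl) = u<h
    above y (there q) with <-cmp y u
    ... | tri< y<u _ _ = ⊥-elim (no312 h y (subseq₂-++⁺ʳ B (here₂ q)) y<u u<h)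
    ... | tri≈ _ e _ = ⊥-elim (≢u y (∈-++⁺ʳ B (there q)) e)
    ... | tri> _ _ gt = gt

  same-interval⇒≡ : ∀ o u v → o < u → o < v → (∀ x → o < x → x < u → x < v) →
    (∀ x → o < x → x < v → x < u) → u ≡ v
  same-interval⇒≡ o u v ou ov f g with <-cmp u v
  ... | tri≈ _ e _ = e
  ... | tri< u<v _ _ = ⊥-elim (<-irrefl refl (g u ou u<v))
  ... | tri> _ _ v<u = ⊥-elim (<-irrefl refl (f v ov v<u))

  -- The first child's word is the maximal prefix below the first label u.
  module FirstChild {u us o B R r} (H : DecodableForest (u ∷ us) o (B ++ R) r)
                    (below : ∀ x → x ∈ B → x < u) (notBelow : ∀ y ys → R ≡ y ∷ ys → ¬ y < u) where
    open DecodableForest H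

    o<u : o < u
    o<u = labels-above u (here refl)

    rest-above-u : ∀ y → y ∈ R → u < y
    rest-above-u = rest-above u B R (λ x p e → disjoint x p (here e))
        (λ x y s → no312-label x y s u (here refl)) notBelow

    split : BlocksSplit B R r
    split = hasBlocks-split u B R r hasBlocks below rest-above-u

    open BlocksSplit split public using (r₁; r₂; sum; blocks₁; blocks₂)

    first-child-complete : ∀ x → o < x → x < u → x ∈ B
    first-child-complete x ox xu with ∈-++⁻ B (complete x u ox (here refl) xu not-label)
      where
      not-label : x ∈ u ∷ us → ⊥
      not-label (here e) = <-irrefl e xu
      not-label (there q) = <-asym xu (labels-ascending u x (here₂ q))
    ... | inj₁ q = q
    ... | inj₂ q = ⊥-elim (<-asym xu (rest-above-u x q))

    first-decodable : Decodable o u r₁ B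
    first-decodable = decodable (distinct-++⁻ˡ B distinct) (λ x p → above x (∈-++⁺ˡ p) , below x p)
      first-child-complete (avoids312-++⁻ˡ B avoids312) blocks₁

    rest-decodable : DecodableForest us u R r₂
    rest-decodable = record
      { labels-ascending = λ a b s → labels-ascending a b (there₂ s)
      ; labels-above = λ v p → labels-ascending u v (here₂ p)
      ; distinct = distinct-++⁻ʳ B distinct
      ; above = rest-above-u
      ; disjoint = λ x p q → disjoint x (∈-++⁺ʳ B p) (there q)
      ; below-label = below-label′
      ; complete = complete′
      ; avoids312 = avoids312-++⁻ʳ B avoids312
      ; no312-label = λ x y s v vm yv vx → no312-label x y (subseq₂-++⁺ʳ B s) v (there vm) yv vx
      ; hasBlocks = blocks₂ }
      where
      below-label′ : ∀ x → x ∈ R → Σ ℕ λ v → v ∈ us × x < v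
      below-label′ x p with below-label x (∈-++⁺ʳ B p)
      ... | v , here refl , xv = ⊥-elim (<-asym xv (rest-above-u x p))
      ... | v , there q , xv = v , q , xv
      complete′ : ∀ x v → u < x → v ∈ us → x < v → (x ∈ us → ⊥) → x ∈ R
      complete′ x v ux vm xv nx with ∈-++⁻ B (complete x v (<-trans o<u ux) (there vm) xv not-label)
        where
        not-label : x ∈ u ∷ us → ⊥
        not-label (here e) = <-irrefl (sym e) ux
        not-label (there q) = nx q
      ... | inj₁ q = ⊥-elim (<-asym ux (below x q))
      ... | inj₂ q = q

    first-label : ∀ t → treeWord t o ≡ B → suc (o + #edges t) ≡ u
    first-label t e = same-interval⇒≡ o (suc (o + #edges t)) u (s≤s (m≤m+n o _)) o<u
      (λ x ox xv → below x (subst (x ∈_) e (∈-treeWord⁺ t o ox (≤-pred xv))))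
      (λ x ox xu → s≤s (proj₂ (∈-treeWord⁻ t o (subst (x ∈_) (sym e) (first-child-complete x ox xu)))))

    consDecoding : TreeDecoding o r₁ B → ForestDecoding us u R r₂ → ForestDecoding (u ∷ us) o (B ++ R) r
    consDecoding (t , full , size , word) (ts , fulls , len , sizes , words , labels) =
      t ∷ ts , full ∷ fulls , cong suc len , trans (cong₂ _+_ size sizes) sum ,
      cong₂ _++_ word (subst (λ z → forestWord ts z ≡ R) (sym label) words) ,
      cong₂ _∷_ label (subst (λ z → rootLabels ts z ≡ us) (sym label) labels)
      where
      label : suc (o + #edges t) ≡ u
      label = first-label t word

  length-prefix : ∀ (pre : List ℕ) x rest f → length (pre ++ x ∷ rest) ≤ suc f → length pre ≤ f
  length-prefix pre x rest f le =
    ≤-pred (≤-trans (subst (suc (length pre) ≤_)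
        (sym (trans (length-++ pre) (+-suc (length pre) (length rest))))
                           (s≤s (m≤m+n (length pre) (length rest)))) le)

  mutual
    decode : ∀ f l o c r → length l ≤ f → Decodable o c r l → TreeDecoding o r l
    decode f [] o c r _ d rewrite hasBlocks-[]⇒0 (Decodable.hasBlocks d) = leaf , leaf , refl , refl
    decode zero (x ∷ l) o c r () d
    decode (suc f) (x ∷ l) o c zero _ d with hasBlocks-0⇒[] (Decodable.hasBlocks d)
    ... | ()
    decode (suc f) l o c (suc r) le d with splitLastBlock r l (Decodable.hasBlocks d)
    ... | lastBlock pre top rest refl len-rest pre-blocks desc asc
      with decodeForest f (reverse (top ∷ rest)) o pre r (length-prefix pre top rest f le)
             (decodable⇒decodableForest d pre-blocks desc asc)
    ... | ts , fulls , len , sizes , words , labels =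
      node ts , node (trans len (trans (length-reverse (top ∷ rest)) (cong suc len-rest))) fulls ,
          cong suc sizes ,
      cong₂ _++_ words (trans (cong reverse labels) (reverse-involutive (top ∷ rest)))

    decodeForest : ∀ f us o w r → length w ≤ f → DecodableForest us o w r → ForestDecoding us o w r
    decodeForest f [] o w r _ H with no-members⇒[] w (λ x p → no-label (DecodableForest.below-label H x p))
      where
      no-label : ∀ {x} → (Σ ℕ λ u → u ∈ [] × x < u) → ⊥
      no-label (_ , () , _)
    ... | refl = [] , [] , refl , sym (hasBlocks-[]⇒0 (DecodableForest.hasBlocks H)) , refl , refl
    decodeForest f (u ∷ us) o w r le H with spanBelow u w
    ... | B , R , refl , below , notBelow =
      consDecoding (decode f B o u r₁
          (≤-trans (subst (length B ≤_) (sym (length-++ B)) (m≤m+n _ _)) le) first-decodable)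
           (decodeForest f us u R r₂
               (≤-trans (subst (length R ≤_) (sym (length-++ B)) (m≤n+m _ _)) le) rest-decodable)
      where open FirstChild H below notBelow


  #edges-full : ∀ t → Full j t → #edges t ≡ suc j * #internal t
  #edges-full t v = trans (sym (length-treeWord t 0)) (proj₂ (treeWord-hasBlocks t 0 v))

  suc-j* : ∀ m → suc j * m ≡ (j + 1) * m
  suc-j* m = cong (_* m) (+-comm 1 j)

  permOf : (m : ℕ) → Tree → Vec ℕ ((j + 1) * m)
  permOf m t = listToVec ((j + 1) * m) (treeWord t 0)

  module _ {m t} (full : Full j t) (size : #internal t ≡ m) where

    length-treeWord-full : length (treeWord t 0) ≡ (j + 1) * m
    length-treeWord-full = trans (length-treeWord t 0)
        (trans (#edges-full t full) (trans (cong (suc j *_) size) (suc-j* m)))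

    toList-permOf : toList (permOf m t) ≡ treeWord t 0
    toList-permOf = toList-listToVec ((j + 1) * m) (treeWord t 0) length-treeWord-full

    permOf-good : GoodPerm j m (permOf m t)
    permOf-good =
      subst (_↭ map suc (upTo ((j + 1) * m))) (sym toList-permOf)
        (↭-trans (treeWord-↭ t 0)
          (↭-reflexive (trans (cong (interval 0) (trans (sym (length-treeWord t 0)) length-treeWord-full))
                              (sym (map-suc-upTo≡interval ((j + 1) * m)))))) ,
      avoids312ᴸ⇒avoids312 (permOf m t) (subst Avoids312ᴸ (sym toList-permOf) (treeWord-avoids312 t 0)) ,
      trans (cong udList toList-permOf) (trans (proj₁ (treeWord-hasBlocks t 0 full)) (cong (blocks j) size))

  permOf-injective : ∀ m t t′ → Full j t → Full j t′ → #internal t ≡ m → #internal t′ ≡ m →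
    permOf m t ≡ permOf m t′ → t ≡ t′
  permOf-injective m t t′ v v′ s s′ e =
    treeWord-injective t t′ 0 v v′
        (trans (sym (toList-permOf v s)) (trans (cong toList e) (toList-permOf v′ s′)))

  permOf-surjective : ∀ m a → GoodPerm j m a → Σ Tree λ t → Full j t × #internal t ≡ m × permOf m t ≡ a
  permOf-surjective m a (perm , av , ud) with decode (length (toList a)) (toList a) 0 (suc N) m ≤-refl good
    where
    N : ℕ
    N = (j + 1) * m
    perm′ : toList a ↭ interval 0 N
    perm′ = ↭-trans perm (↭-reflexive (map-suc-upTo≡interval N))
    good : Decodable 0 (suc N) m (toList a)
    good = decodable (distinct-↭ perm′ (interval-distinct 0 N))
      (λ x p → let q = ∈-interval⁻ 0 N (∈-resp-↭ perm′ p) in proj₁ q , s≤s (proj₂ q))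
      (λ x ox xN → ∈-resp-↭ (↭-sym perm′) (∈-interval⁺ 0 N ox (≤-pred xN)))
      (avoids312⇒avoids312ᴸ a av)
      (ud , trans (length-toList a) (sym (suc-j* m)))
  ... | t , v , s , e = t , v , s , trans (cong (listToVec ((j + 1) * m)) e) (listToVec-toList a)

  permOf-coding : ∀ m → Coding (FullOfSize j m) (GoodPerm j m) (permOf m)
  permOf-coding m = record
    { sound = λ t (full , size) → permOf-good full size
    ; injective = λ t t′ (full , size) (full′ , size′) → permOf-injective m t t′ full full′ size size′
    ; surjective = λ a good →
        let (t , full , size , e) = permOf-surjective m a good in t , (full , size) , e }

-- Dissected polygons

_≟ₚ_ : (e f : ℕ × ℕ) → Dec (e ≡ f)
_≟ₚ_ = ×-≡-dec _≟_ _≟_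

SideOf : ℕ → ℕ → ℕ → ℕ → Set
SideOf a b x y = y ≡ suc x ⊎ (x ≡ a × y ≡ b)

EdgeOf : ℕ → ℕ → (ℕ × ℕ → Set) → ℕ → ℕ → Set
EdgeOf a b Δ x y = SideOf a b x y ⊎ Δ (x , y)

-- A region of a dissection Δ of the polygon with vertices a, a+1, …, b, closed by the side (a, b).
record RegionOf (a b : ℕ) (Δ : ℕ × ℕ → Set) (S : List ℕ) : Set where
  constructor region
  field
    sorted   : Linked _<_ S
    size≥3   : 3 ≤ length S
    bounded  : ∀ v → v ∈ S → a ≤ v × v ≤ b
    sides    : ∀ x y → x ∈ S → y ∈ S → x < y → ConsecIn S x y → EdgeOf a b Δ x y
    no-chord : ∀ x y → x ∈ S → y ∈ S → Δ (x , y) → ConsecIn S x y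

Consecutive : List ℕ → ℕ → ℕ → Set
Consecutive Q c d = c ∈ Q × d ∈ Q × c < d × (∀ q → q ∈ Q → ¬ (c < q × q < d))

head-≤ : ∀ {h L z} → Linked _<_ (h ∷ L) → z ∈ h ∷ L → h ≤ z
head-≤ lk (here refl) = ≤-refl
head-≤ lk (there p) = <⇒≤ (linked-subseq₂ <-trans lk (here₂ p))

≤-lastOf : ∀ {h L z} → Linked _<_ (h ∷ L) → z ∈ h ∷ L → z ≤ lastOf h L
≤-lastOf {h} {[]} lk (here refl) = ≤-refl
≤-lastOf {h} {x ∷ L} (r ∷ lk) (here refl) = <⇒≤ (<-≤-trans r (≤-lastOf lk (here refl)))
≤-lastOf {h} {x ∷ L} (r ∷ lk) (there p) = ≤-lastOf lk p

linked-head : ∀ {A : Set} {R : A → A → Set} → Transitive R → ∀ {h L z} → Linked R (h ∷ L) → z ∈ L → R h z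
linked-head tr (r ∷ lk) (here refl) = r
linked-head tr (r ∷ lk) (there p) = tr r (linked-head tr lk p)

sorted-≡ : ∀ {A : Set} {R : A → A → Set} → Transitive R → (∀ {a} → R a a → ⊥) →
  ∀ {L₁ L₂} → Linked R L₁ → Linked R L₂ → (∀ z → z ∈ L₁ → z ∈ L₂) → (∀ z → z ∈ L₂ → z ∈ L₁) → L₁ ≡ L₂
sorted-≡ tr ir {[]} {[]} _ _ f g = refl
sorted-≡ tr ir {[]} {x ∷ L₂} _ _ f g with g x (here refl)
... | ()
sorted-≡ tr ir {x ∷ L₁} {[]} _ _ f g with f x (here refl)
... | ()
sorted-≡ tr ir {x ∷ L₁} {y ∷ L₂} l₁ l₂ f g with f x (here refl) | g y (here refl)
... | here refl | _ = cong (x ∷_) (sorted-≡ tr ir (Linked.tail l₁) (Linked.tail l₂) f′ g′)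
  where
  f′ : ∀ z → z ∈ L₁ → z ∈ L₂
  f′ z p with f z (there p)
  ... | here refl = ⊥-elim (ir (linked-head tr l₁ p))
  ... | there q = q
  g′ : ∀ z → z ∈ L₂ → z ∈ L₁
  g′ z p with g z (there p)
  ... | here refl = ⊥-elim (ir (linked-head tr l₂ p))
  ... | there q = q
... | there p | here refl = ⊥-elim (ir (linked-head tr l₂ p))
... | there p | there q = ⊥-elim (ir (tr (linked-head tr l₂ p) (linked-head tr l₁ q)))

straddlingPair : ∀ {L x y} v → Linked _<_ L → x ∈ L → x < v → y ∈ L → v ≤ y →
  Σ ℕ λ s → Σ ℕ λ s' → s ∈ L × s' ∈ L × s < v × v ≤ s' × (∀ z → z ∈ L → ¬ (s < z × z < s'))
straddlingPair {h ∷ L} v lk xm xv ym vy with h <? v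
... | no ¬hv = ⊥-elim (¬hv (≤-<-trans (head-≤ lk xm) xv))
straddlingPair {h ∷ []} v lk xm xv (here refl) vy | yes hv = ⊥-elim (<-irrefl refl (<-≤-trans hv vy))
straddlingPair {h ∷ []} v lk xm xv (there ()) vy | yes hv
straddlingPair {h ∷ h' ∷ L} v (r ∷ lk) xm xv ym vy | yes hv with v ≤? h'
... | yes vh' = h , h' , here refl , there (here refl) , hv , vh' , nb
  where
  nb : ∀ z → z ∈ h ∷ h' ∷ L → ¬ (h < z × z < h')
  nb z (here refl) (a , _) = <-irrefl refl a
  nb z (there q) (_ , b) = <-irrefl refl (<-≤-trans b (head-≤ lk q))
... | no ¬vh' with ym
...   | here refl = ⊥-elim (<-irrefl refl (<-≤-trans hv vy))
...   | there ym' with straddlingPair v lk (here refl) (≰⇒> ¬vh') ym' vy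
...     | s , s' , sm , s'm , sv , vs' , nb = s , s' , there sm , there s'm , sv , vs' , nb'
  where
  nb' : ∀ z → z ∈ h ∷ h' ∷ L → ¬ (s < z × z < s')
  nb' z (here refl) (a , _) = <-asym a (<-≤-trans r (head-≤ lk sm))
  nb' z (there q) = nb z q

middle-vertex : ∀ {s0 S'} → Linked _<_ (s0 ∷ S') → 3 ≤ length (s0 ∷ S') → Σ ℕ λ m →
  m ∈ (s0 ∷ S') × s0 < m × m < lastOf s0 S'
middle-vertex {s0} {s1 ∷ s2 ∷ S''} (r1 ∷ r2 ∷ lk) _ = s1 , there (here refl) , r1 ,
    <-≤-trans r2 (≤-lastOf lk (here refl))
middle-vertex {s0} {[]} _ (s≤s ())
middle-vertex {s0} {s1 ∷ []} _ (s≤s (s≤s ()))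

module RegionFacts {a b : ℕ} {Δ : ℕ × ℕ → Set} {s0 : ℕ} {S' : List ℕ} (R : RegionOf a b Δ (s0 ∷ S')) where
  S : List ℕ
  S = s0 ∷ S'
  open RegionOf R public
  last : ℕ
  last = lastOf s0 S'
  last∈ : last ∈ S
  last∈ = lastOf-∈ s0 S'
  first-last-consec : ConsecIn S s0 last
  first-last-consec = inj₂ (λ z p → head-≤ sorted p , ≤-lastOf sorted p)
  middle : Σ ℕ λ m → m ∈ S × s0 < m × m < last
  middle = middle-vertex sorted size≥3
  first<last : s0 < last
  first<last = <-trans (proj₁ (proj₂ (proj₂ middle))) (proj₂ (proj₂ (proj₂ middle)))
  first-last-edge : EdgeOf a b Δ s0 last
  first-last-edge = sides s0 last (here refl) last∈ first<last first-last-consec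
  consecutive-edge : ∀ s s' → s ∈ S → s' ∈ S → s < s' → (∀ z → z ∈ S → ¬ (s < z × z < s')) → EdgeOf a b Δ s s'
  consecutive-edge s s' p q lt nb = sides s s' p q lt (inj₁ nb)

module Separation {a b : ℕ} {Δ : ℕ × ℕ → Set} {s0 : ℕ} {S' : List ℕ} (R : RegionOf a b Δ (s0 ∷ S')) {c d : ℕ}
  (cd-edge : EdgeOf a b Δ c d)
  (uncrossed : ∀ x y → a ≤ x → y ≤ b → x < y → EdgeOf a b Δ x y → ¬ Cross (c , d) (x , y)) where
  open RegionFacts R

  ¬exit-right : ∀ x y → x ∈ S → y ∈ S → x < y → EdgeOf a b Δ x y → c < x → x < d → d < y → ⊥
  ¬exit-right x y xm ym xy e cx xd dy = uncrossed x y (proj₁ (bounded x xm)) (proj₂ (bounded y ym)) xy e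
      (inj₁ (cx , xd , dy))
  ¬exit-left : ∀ x y → x ∈ S → y ∈ S → x < y → EdgeOf a b Δ x y → x < c → c < y → y < d → ⊥
  ¬exit-left x y xm ym xy e xc cy yd = uncrossed x y (proj₁ (bounded x xm)) (proj₂ (bounded y ym)) xy e
      (inj₂ (xc , cy , yd))

  d∈region : ∀ {x s} → x ∈ S → c < x → x < d → s ∈ S → d ≤ s → d ∈ S
  d∈region {x} xm cx xd sm ds with straddlingPair d sorted xm xd sm ds
  ... | s1 , s1' , m1 , m1' , s1d , ds1' , nb with <-cmp d s1'
  ...   | tri≈ _ e _ = subst (_∈ S) (sym e) m1'
  ...   | tri> _ _ gt = ⊥-elim (<-irrefl refl (<-≤-trans gt ds1'))
  ...   | tri< lt _ _ = ⊥-elim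
      (¬exit-right s1 s1' m1 m1' (<-≤-trans s1d ds1')
      (consecutive-edge s1 s1' m1 m1' (<-≤-trans s1d ds1') nb) cs1 s1d lt)
    where
    cs1 : c < s1
    cs1 with <-cmp s1 x
    ... | tri< s1x _ _ = ⊥-elim (nb x xm (s1x , <-≤-trans xd ds1'))
    ... | tri≈ _ e _ = subst (c <_) (sym e) cx
    ... | tri> _ _ gt = <-trans cx gt

  c∈region : ∀ {x s} → x ∈ S → c < x → x < d → s ∈ S → s ≤ c → c ∈ S
  c∈region {x} xm cx xd sm sc with straddlingPair (suc c) sorted sm (s≤s sc) xm cx
  ... | s2 , s2' , m2 , m2' , s2c , cs2' , nb with <-cmp s2 c
  ...   | tri≈ _ e _ = subst (_∈ S) e m2
  ...   | tri> _ _ gt = ⊥-elim (<-irrefl refl (<-≤-trans gt (≤-pred s2c)))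
  ...   | tri< lt _ _ = ⊥-elim
      (¬exit-left s2 s2' m2 m2' (<-trans lt cs2')
      (consecutive-edge s2 s2' m2 m2' (<-trans lt cs2') nb) lt cs2' s2'd)
    where
    s2'd : s2' < d
    s2'd with <-cmp x s2'
    ... | tri< xs _ _ = ⊥-elim (nb x xm (≤-<-trans (≤-pred s2c) cx , xs))
    ... | tri≈ _ e _ = subst (_< d) e xd
    ... | tri> _ _ gt = <-trans gt xd

  no-vertex-outside : ∀ {x z} → EdgeOf a b Δ c d → c ∈ S → d ∈ S → x ∈ S → c < x → x < d → z ∈ S →
    (z < c ⊎ d < z) → ⊥
  no-vertex-outside e cm dm xm cx xd zm out with e
  ... | inj₁ (inj₁ refl) = <-irrefl refl (<-≤-trans cx (≤-pred xd))
  ... | inj₁ (inj₂ (refl , refl)) with out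
  ...   | inj₁ zc = <-irrefl refl (<-≤-trans zc (proj₁ (bounded _ zm)))
  ...   | inj₂ dz = <-irrefl refl (<-≤-trans dz (proj₂ (bounded _ zm)))
  no-vertex-outside e cm dm xm cx xd zm out | inj₂ dp with no-chord c d cm dm dp
  ... | inj₁ f = f _ xm (cx , xd)
  ... | inj₂ g with out
  ...   | inj₁ zc = <-irrefl refl (<-≤-trans zc (proj₁ (g _ zm)))
  ...   | inj₂ dz = <-irrefl refl (<-≤-trans dz (proj₂ (g _ zm)))

  d∈region-from-below : ∀ {x z} → x ∈ S → c < x → x < d → z ∈ S → z < c → d ∈ S
  d∈region-from-below xm cx xd zm zc with d ≤? last
  ... | yes dsl = d∈region xm cx xd last∈ dsl
  ... | no n = ⊥-elim (¬exit-left s0 last (here refl) last∈ first<last first-last-edge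
      (≤-<-trans (head-≤ sorted zm) zc) (<-≤-trans cx (≤-lastOf sorted xm)) (≰⇒> n))

  c∈region-from-above : ∀ {x z} → x ∈ S → c < x → x < d → z ∈ S → d < z → c ∈ S
  c∈region-from-above xm cx xd zm dz with s0 ≤? c
  ... | yes s0c = c∈region xm cx xd (here refl) s0c
  ... | no n = ⊥-elim (¬exit-right s0 last (here refl) last∈ first<last first-last-edge (≰⇒> n)
      (≤-<-trans (head-≤ sorted xm) xd) (<-≤-trans dz (≤-lastOf sorted zm)))

  region-inside : ∀ x → x ∈ S → c < x → x < d → ∀ z → z ∈ S → c ≤ z × z ≤ d
  region-inside x xm cx xd z zm with z <? c
  ... | yes zc = ⊥-elim (no-vertex-outside cd-edge (c∈region xm cx xd zm (<⇒≤ zc))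
      (d∈region-from-below xm cx xd zm zc) xm cx xd zm (inj₁ zc))
  ... | no ¬zc with d <? z
  ...   | yes dz = ⊥-elim (no-vertex-outside cd-edge (c∈region-from-above xm cx xd zm dz)
      (d∈region xm cx xd zm (<⇒≤ dz)) xm cx xd zm (inj₂ dz))
  ...   | no ¬dz = ≮⇒≥ ¬zc , ≮⇒≥ ¬dz

⊆-or-witness : ∀ (S Q : List ℕ) → (∀ s → s ∈ S → s ∈ Q) ⊎ Σ ℕ λ s → s ∈ S × (s ∈ Q → ⊥)
⊆-or-witness [] Q = inj₁ (λ _ ())
⊆-or-witness (x ∷ S) Q with x ∈? Q
... | no n = inj₂ (x , here refl , n)
... | yes p with ⊆-or-witness S Q
...   | inj₁ f = inj₁ (λ { s (here refl) → p ; s (there q) → f s q })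
...   | inj₂ (s , sm , n) = inj₂ (s , there sm , n)

FrameEdge : ℕ → ℕ → List ℕ → ℕ → ℕ → Set
FrameEdge a b Q x y = (x ≡ a × y ≡ b) ⊎ Consecutive Q x y ⊎
    (Σ ℕ λ c → Σ ℕ λ d → Consecutive Q c d × c ≤ x × y ≤ d)

module Frame {a b : ℕ} {Δ : ℕ × ℕ → Set} {Q' : List ℕ} (srtQ : Linked _<_ (a ∷ Q')) (lastQ : lastOf a Q' ≡ b)
  (lenQ : 3 ≤ length (a ∷ Q'))
  (frame-edge : ∀ x y → a ≤ x → y ≤ b → x < y → EdgeOf a b Δ x y → FrameEdge a b (a ∷ Q') x y)
  (frame-consecutive-edge : ∀ c d → Consecutive (a ∷ Q') c d → EdgeOf a b Δ c d) where
  Q : List ℕ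
  Q = a ∷ Q'

  b∈Q : b ∈ Q
  b∈Q = subst (_∈ Q) lastQ (lastOf-∈ a Q')

  frame-range : ∀ {q} → q ∈ Q → a ≤ q × q ≤ b
  frame-range p = head-≤ srtQ p , subst (_ ≤_) lastQ (≤-lastOf srtQ p)

  consecutive-unique : ∀ {c d c' d'} → Consecutive Q c d → Consecutive Q c' d' → c < d' → c' < d →
    c ≡ c' × d ≡ d'
  consecutive-unique {c} {d} {c'} {d'} (cm , dm , cd , nb) (cm' , dm' , cd' , nb') cd'' c'd with <-cmp c c'
  ... | tri< lt _ _ = ⊥-elim (nb c' cm' (lt , c'd))
  ... | tri> _ _ gt = ⊥-elim (nb' c cm (gt , cd''))
  ... | tri≈ _ refl _ with <-cmp d d'
  ...   | tri< lt _ _ = ⊥-elim (nb' d dm (cd , lt))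
  ...   | tri> _ _ gt = ⊥-elim (nb d' dm' (cd' , gt))
  ...   | tri≈ _ e _ = refl , e

  consecutive-around : ∀ v → a ≤ v → v ≤ b → (v ∈ Q → ⊥) → Σ ℕ λ c → Σ ℕ λ d →
    Consecutive Q c d × c < v × v < d
  consecutive-around v av vb nv with straddlingPair v srtQ (here refl)
      (≤∧≢⇒< av (λ e → nv (subst (_∈ Q) e (here refl)))) b∈Q vb
  ... | s , s' , sm , s'm , sv , vs' , nb =
        s , s' , (sm , s'm , <-≤-trans sv vs' , nb) , sv , ≤∧≢⇒< vs' (λ e → nv (subst (_∈ Q) (sym e) s'm))

  consecutive-uncrossed : ∀ {c d} → Consecutive Q c d →
    ∀ x y → a ≤ x → y ≤ b → x < y → EdgeOf a b Δ x y → ¬ Cross (c , d) (x , y)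
  consecutive-uncrossed adj@(cm , dm , cd , nb) x y ax yb xy e (inj₁ (cx , xd , dy))
    with frame-edge x y ax yb xy e
  ... | inj₁ (refl , _) = <-irrefl refl (≤-<-trans (proj₁ (frame-range cm)) cx)
  ... | inj₂ (inj₁ (xm , _)) = nb x xm (cx , xd)
  ... | inj₂ (inj₂ (c′ , d′ , adj′ , c′x , yd′))
    with consecutive-unique adj adj′ (<-trans cx (<-≤-trans xy yd′)) (≤-<-trans c′x xd)
  ...   | _ , refl = <-irrefl refl (<-≤-trans dy yd′)
  consecutive-uncrossed {c} (cm , dm , cd , nb) x y ax yb xy e (inj₂ (xc , cy , yd))
    with frame-edge x y ax yb xy e
  ... | inj₁ (_ , refl) = <-irrefl refl (<-≤-trans yd (proj₂ (frame-range dm)))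
  ... | inj₂ (inj₁ (_ , _ , _ , nb′)) = nb′ c cm (xc , cy)
  ... | inj₂ (inj₂ (c′ , d′ , (_ , _ , _ , nb′) , c′x , yd′)) = nb′ c cm (≤-<-trans c′x xc , <-≤-trans cy yd′)

  region⊆frame⇒frame : ∀ {s0 S'} → RegionOf a b Δ (s0 ∷ S') → (∀ s → s ∈ s0 ∷ S' → s ∈ Q) → s0 ∷ S' ≡ Q
  region⊆frame⇒frame {s0} {S'} R sub = sorted-≡ <-trans (<-irrefl refl) sorted srtQ sub sup
    where
    open RegionFacts R
    m : ℕ
    m = proj₁ middle
    mm : m ∈ S
    mm = proj₁ (proj₂ middle)
    s0m : s0 < m
    s0m = proj₁ (proj₂ (proj₂ middle))
    msl : m < last
    msl = proj₂ (proj₂ (proj₂ middle))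
    ends : s0 ≡ a × last ≡ b
    ends with frame-edge s0 last (proj₁ (bounded s0 (here refl))) (proj₂ (bounded last last∈))
                first<last first-last-edge
    ... | inj₁ e = e
    ... | inj₂ (inj₁ (_ , _ , _ , nb)) = ⊥-elim (nb m (sub m mm) (s0m , msl))
    ... | inj₂ (inj₂ (c , d , (_ , _ , _ , nb) , cs0 , sld)) =
      ⊥-elim (nb m (sub m mm) (≤-<-trans cs0 s0m , <-≤-trans msl sld))
    sup : ∀ q → q ∈ Q → q ∈ S
    sup q qm with q ∈? S
    ... | yes p = p
    ... | no np with straddlingPair q sorted (here refl) s0q last∈ (<⇒≤ qsl)
      where
      s0q : s0 < q
      s0q = ≤∧≢⇒< (subst (_≤ q) (sym (proj₁ ends)) (proj₁ (frame-range qm)))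
                  (λ e → np (subst (_∈ S) e (here refl)))
      qsl : q < last
      qsl = ≤∧≢⇒< (subst (q ≤_) (sym (proj₂ ends)) (proj₂ (frame-range qm)))
                  (λ e → np (subst (_∈ S) (sym e) last∈))
    ... | s₁ , s₁′ , m₁ , m₁′ , s₁q , qs₁′ , nb
      with frame-edge s₁ s₁′ (proj₁ (bounded s₁ m₁)) (proj₂ (bounded s₁′ m₁′)) (<-≤-trans s₁q qs₁′)
             (consecutive-edge s₁ s₁′ m₁ m₁′ (<-≤-trans s₁q qs₁′) nb)
    ...   | inj₁ (refl , refl) =
      ⊥-elim (nb m mm (subst (_< m) (proj₁ ends) s0m , subst (m <_) (proj₂ ends) msl))
    ...   | inj₂ (inj₁ (_ , _ , _ , nb′)) =
      ⊥-elim (nb′ q qm (s₁q , ≤∧≢⇒< qs₁′ (λ e → np (subst (_∈ S) (sym e) m₁′))))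
    ...   | inj₂ (inj₂ (c , d , (_ , _ , _ , nb′) , cs₁ , s₁′d)) =
      ⊥-elim (nb′ q qm (≤-<-trans cs₁ s₁q , <-≤-trans (≤∧≢⇒< qs₁′ (λ e → np (subst (_∈ S) (sym e) m₁′))) s₁′d))

  classify-region : ∀ {s0 S'} → RegionOf a b Δ (s0 ∷ S') →
    (s0 ∷ S') ≡ Q ⊎ Σ ℕ λ c → Σ ℕ λ d → Consecutive Q c d × (∀ s → s ∈ s0 ∷ S' → c ≤ s × s ≤ d)
  classify-region {s0} {S'} R with ⊆-or-witness (s0 ∷ S') Q
  ... | inj₁ sub = inj₁ (region⊆frame⇒frame R sub)
  ... | inj₂ (s , sm , ns)
    with consecutive-around s (proj₁ (RegionOf.bounded R s sm)) (proj₂ (RegionOf.bounded R s sm)) ns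
  ...   | c , d , adj , cs , sd =
    inj₂ (c , d , adj ,
          Separation.region-inside R (frame-consecutive-edge c d adj) (consecutive-uncrossed adj) s sm cs sd)

  frame-region : (∀ x y → Δ (x , y) → x < y) → ¬ Δ (a , b) → RegionOf a b Δ Q
  frame-region Dlt noAB = region srtQ lenQ (λ v p → frame-range p) sides no-chord
    where
    sides : ∀ x y → x ∈ Q → y ∈ Q → x < y → ConsecIn Q x y → EdgeOf a b Δ x y
    sides x y xm ym lt (inj₁ nb) = frame-consecutive-edge x y (xm , ym , lt , nb)
    sides x y xm ym lt (inj₂ g) = inj₁ (inj₂ (≤-antisym (proj₁ (g a (here refl))) (proj₁ (frame-range xm)) ,
                                            ≤-antisym (proj₂ (frame-range ym)) (proj₂ (g b b∈Q))))
    no-chord : ∀ x y → x ∈ Q → y ∈ Q → Δ (x , y) → ConsecIn Q x y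
    no-chord x y xm ym dp with frame-edge x y (proj₁ (frame-range xm)) (proj₂ (frame-range ym)) (Dlt x y dp)
        (inj₂ dp)
    ... | inj₁ (refl , refl) = ⊥-elim (noAB dp)
    ... | inj₂ (inj₁ (_ , _ , _ , nb)) = inj₁ nb
    ... | inj₂ (inj₂ (c , d , (cm , dm , cd , nb) , cx , yd)) = inj₁ nb'
      where
      xc : x ≡ c
      xc with <-cmp c x
      ... | tri< lt _ _ = ⊥-elim (nb x xm (lt , <-≤-trans (Dlt x y dp) yd))
      ... | tri≈ _ e _ = sym e
      ... | tri> _ _ gt = ⊥-elim (<-irrefl refl (<-≤-trans gt cx))
      yd' : y ≡ d
      yd' with <-cmp y d
      ... | tri< lt _ _ = ⊥-elim (nb y ym (≤-<-trans cx (Dlt x y dp) , lt))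
      ... | tri≈ _ e _ = e
      ... | tri> _ _ gt = ⊥-elim (<-irrefl refl (<-≤-trans gt yd))
      nb' : ∀ z → z ∈ Q → ¬ (x < z × z < y)
      nb' z zm rewrite xc | yd' = nb z zm

region-restrict : ∀ {a b c d Δ Δ′ S} → RegionOf a b Δ S → (∀ s → s ∈ S → c ≤ s × s ≤ d) → a ≤ c → d ≤ b →
  ¬ (c ≡ a × d ≡ b) →
  (∀ x y → c ≤ x → y ≤ d → x < y → Δ (x , y) → SideOf c d x y ⊎ Δ′ (x , y)) → (∀ e → Δ′ e → Δ e) →
      RegionOf c d Δ′ S
region-restrict {a} {b} {c} {d} {Δ} {Δ′} {S}
    (region sorted size≥3 bounded sides no-chord) inS ac db nab conv sub =
  region sorted size≥3 inS sides′ (λ x y xm ym dp → no-chord x y xm ym (sub _ dp))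
  where
  sides′ : ∀ x y → x ∈ S → y ∈ S → x < y → ConsecIn S x y → EdgeOf c d Δ′ x y
  sides′ x y xm ym lt ci with sides x y xm ym lt ci
  ... | inj₁ (inj₁ e) = inj₁ (inj₁ e)
  ... | inj₁ (inj₂ (refl , refl)) = ⊥-elim
      (nab (≤-antisym (proj₁ (inS x xm)) ac , ≤-antisym db (proj₂ (inS y ym))))
  ... | inj₂ dp with conv x y (proj₁ (inS x xm)) (proj₂ (inS y ym)) lt dp
  ...   | inj₁ s = inj₁ s
  ...   | inj₂ dp' = inj₂ dp'

region-lift : ∀ {a b c d Δ Δ′ S} → RegionOf c d Δ′ S → EdgeOf a b Δ c d → (∀ e → Δ′ e → Δ e) →
  (∀ x y → c ≤ x → y ≤ d → Δ (x , y) → (x ≡ c × y ≡ d) ⊎ Δ′ (x , y)) → a ≤ c → d ≤ b → RegionOf a b Δ S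
region-lift {a} {b} {c} {d} {Δ} {Δ′} {S} (region sorted size≥3 bounded sides no-chord) ecd sub conv ac db =
  region sorted size≥3 (λ v p → ≤-trans ac (proj₁ (bounded v p)) , ≤-trans (proj₂ (bounded v p)) db) sides′
      no-chord′
  where
  sides′ : ∀ x y → x ∈ S → y ∈ S → x < y → ConsecIn S x y → EdgeOf a b Δ x y
  sides′ x y xm ym lt ci with sides x y xm ym lt ci
  ... | inj₁ (inj₁ e) = inj₁ (inj₁ e)
  ... | inj₁ (inj₂ (refl , refl)) = ecd
  ... | inj₂ dp = inj₂ (sub _ dp)
  no-chord′ : ∀ x y → x ∈ S → y ∈ S → Δ (x , y) → ConsecIn S x y
  no-chord′ x y xm ym dp with conv x y (proj₁ (bounded x xm)) (proj₂ (bounded y ym)) dp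
  ... | inj₁ (refl , refl) = inj₂ (λ z zm → bounded z zm)
  ... | inj₂ dp' = no-chord x y xm ym dp'

region-cong : ∀ {a b Δ Δ′ S} → RegionOf a b Δ S → (∀ e → Δ e → Δ′ e) → (∀ e → Δ′ e → Δ e) → RegionOf a b Δ′ S
region-cong {a} {b} {Δ} {Δ′} (region sorted size≥3 bounded sides no-chord) f g =
  region sorted size≥3 bounded (λ x y xm ym lt ci → conv (sides x y xm ym lt ci))
      (λ x y xm ym p → no-chord x y xm ym (g _ p))
  where
  conv : ∀ {x y} → EdgeOf a b Δ x y → EdgeOf a b Δ′ x y
  conv (inj₁ s) = inj₁ s
  conv (inj₂ p) = inj₂ (f _ p)

row : ℕ → ℕ → ℕ → List (ℕ × ℕ)
row x y zero = []
row x y (suc c) = (x , y) ∷ row x (suc y) c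

grid : ℕ → ℕ → ℕ → List (ℕ × ℕ)
grid x zero n = []
grid x (suc c) n = row x 0 n ++ grid (suc x) c n

allPairs : ℕ → List (ℕ × ℕ)
allPairs n = grid 0 n n

∈-row⁻ : ∀ {p q} x y c → (p , q) ∈ row x y c → p ≡ x × y ≤ q
∈-row⁻ x y (suc c) (here refl) = refl , ≤-refl
∈-row⁻ x y (suc c) (there m) with ∈-row⁻ x (suc y) c m
... | e , le = e , <⇒≤ le

∈-row⁺ : ∀ x y c q → y ≤ q → q < y + c → (x , q) ∈ row x y c
∈-row⁺ x y zero q yq qc = ⊥-elim (<-irrefl refl (<-≤-trans qc (subst (_≤ q) (sym (+-identityʳ y)) yq)))
∈-row⁺ x y (suc c) q yq qc with y ≟ q
... | yes refl = here refl
... | no ne = there (∈-row⁺ x (suc y) c q (≤∧≢⇒< yq ne) (subst (q <_) (+-suc y c) qc))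

∈-grid⁻ : ∀ {p q} x c n → (p , q) ∈ grid x c n → x ≤ p
∈-grid⁻ x (suc c) n m with ∈-++⁻ (row x 0 n) m
... | inj₁ r = ≤-reflexive (sym (proj₁ (∈-row⁻ x 0 n r)))
... | inj₂ r = <⇒≤ (∈-grid⁻ (suc x) c n r)

∈-grid⁺ : ∀ x c n p q → x ≤ p → p < x + c → q < n → (p , q) ∈ grid x c n
∈-grid⁺ x zero n p q xp pc qn = ⊥-elim (<-irrefl refl (<-≤-trans pc (subst (_≤ p) (sym (+-identityʳ x)) xp)))
∈-grid⁺ x (suc c) n p q xp pc qn with x ≟ p
... | yes refl = ∈-++⁺ˡ (∈-row⁺ x 0 n q z≤n qn)
... | no ne = ∈-++⁺ʳ (row x 0 n) (∈-grid⁺ (suc x) c n p q (≤∧≢⇒< xp ne) (subst (p <_) (+-suc x c) pc) qn)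

∈-allPairs⁺ : ∀ n x y → x < n → y < n → (x , y) ∈ allPairs n
∈-allPairs⁺ n x y xn yn = ∈-grid⁺ 0 n n x y z≤n xn yn

<ᴾ-trans : ∀ {e f g} → e <ᴾ f → f <ᴾ g → e <ᴾ g
<ᴾ-trans (inj₁ a) (inj₁ b) = inj₁ (<-trans a b)
<ᴾ-trans (inj₁ a) (inj₂ (refl , _)) = inj₁ a
<ᴾ-trans (inj₂ (refl , _)) (inj₁ b) = inj₁ b
<ᴾ-trans (inj₂ (refl , a)) (inj₂ (refl , b)) = inj₂ (refl , <-trans a b)

<ᴾ-irrefl : ∀ {e} → e <ᴾ e → ⊥
<ᴾ-irrefl (inj₁ a) = <-irrefl refl a
<ᴾ-irrefl (inj₂ (_ , a)) = <-irrefl refl a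

linked-++⁺ : ∀ {A : Set} {R : A → A → Set} (l1 l2 : List A) → Linked R l1 → Linked R l2 →
  (∀ u v → u ∈ l1 → v ∈ l2 → R u v) → Linked R (l1 ++ l2)
linked-++⁺ [] l2 _ lk2 _ = lk2
linked-++⁺ (u ∷ []) [] _ _ _ = [-]
linked-++⁺ (u ∷ []) (v ∷ l2) _ lk2 h = h u v (here refl) (here refl) ∷ lk2
linked-++⁺ (u ∷ u' ∷ l1) l2 (r ∷ lk1) lk2 h = r ∷ linked-++⁺ (u' ∷ l1) l2 lk1 lk2
    (λ a b p q → h a b (there p) q)

row-sorted : ∀ x y c → Linked _<ᴾ_ (row x y c)
row-sorted x y zero = []
row-sorted x y (suc zero) = [-]
row-sorted x y (suc (suc c)) = inj₂ (refl , ≤-refl) ∷ row-sorted x (suc y) (suc c)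

grid-sorted : ∀ x c n → Linked _<ᴾ_ (grid x c n)
grid-sorted x zero n = []
grid-sorted x (suc c) n = linked-++⁺ (row x 0 n) (grid (suc x) c n) (row-sorted x 0 n)
    (grid-sorted (suc x) c n) h
  where
  h : ∀ u v → u ∈ row x 0 n → v ∈ grid (suc x) c n → u <ᴾ v
  h (p , q) (p' , q') a b = inj₁ (subst (_< p') (sym (proj₁ (∈-row⁻ x 0 n a))) (∈-grid⁻ (suc x) c n b))

-- Dissections from trees

-- Indexed by k with j = suc k, so that every internal node has at least two children.
module AngulationCode (k : ℕ) where
  open import Data.List.Membership.DecPropositional _≟ₚ_ using () renaming (_∈?_ to _∈ₚ?_)

  j : ℕ
  j = suc k

  mutual
    width : Tree → ℕ
    width leaf = 1
    width (node ds) = width* ds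
    width* : List Tree → ℕ
    width* [] = 0
    width* (d ∷ ds) = width d + width* ds

  IsNode : Tree → Set
  IsNode leaf = ⊥
  IsNode (node _) = ⊤

  mutual
    Diagonal : Tree → ℕ → ℕ × ℕ → Set
    Diagonal leaf a e = ⊥
    Diagonal (node ds) a e = Diagonal* ds a e
    Diagonal* : List Tree → ℕ → ℕ × ℕ → Set
    Diagonal* [] a e = ⊥
    Diagonal* (d ∷ ds) a e =
      (IsNode d × e ≡ (a , a + width d)) ⊎ Diagonal d a e ⊎ Diagonal* ds (a + width d) e

  corners : List Tree → ℕ → List ℕ
  corners [] a = []
  corners (d ∷ ds) a = (a + width d) ∷ corners ds (a + width d)

  isNode? : ∀ t → Dec (IsNode t)
  isNode? leaf = no (λ ())
  isNode? (node _) = yes tt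

  mutual
    diagonal? : ∀ t a e → Dec (Diagonal t a e)
    diagonal? leaf a e = no (λ ())
    diagonal? (node ds) a e = diagonal*? ds a e
    diagonal*? : ∀ ds a e → Dec (Diagonal* ds a e)
    diagonal*? [] a e = no (λ ())
    diagonal*? (d ∷ ds) a e = (isNode? d ×-dec (e ≟ₚ (a , a + width d))) ⊎-dec
        (diagonal? d a e ⊎-dec diagonal*? ds (a + width d) e)

  mutual
    width-positive : ∀ t → Full j t → 1 ≤ width t
    width-positive leaf _ = s≤s z≤n
    width-positive (node ds) v = ≤-trans (s≤s z≤n) (width-node≥2 ds v)

    width-node≥2 : ∀ ds → Full j (node ds) → 2 ≤ width* ds
    width-node≥2 (d ∷ d' ∷ ds) (node _ (v ∷ v' ∷ _)) = +-mono-≤ (width-positive d v)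
        (≤-trans (width-positive d' v') (m≤m+n _ _))
    width-node≥2 [] (node () _)
    width-node≥2 (d ∷ []) (node () _)

  2+a≤a+n : ∀ a n → 2 ≤ n → suc (suc a) ≤ a + n
  2+a≤a+n a n h = subst (_≤ a + n) (+-comm a 2) (+-monoʳ-≤ a h)

  a<a+width : ∀ a t → Full j t → a < a + width t
  a<a+width a t v = subst (_≤ a + width t) (+-comm a 1) (+-monoʳ-≤ a (width-positive t v))

  a+width≤ : ∀ a t ds → a + width t ≤ a + (width t + width* ds)
  a+width≤ a t ds = +-monoʳ-≤ a (m≤m+n (width t) (width* ds))

  mutual
    diagonal-range : ∀ t a {x y} → Full j t → Diagonal t a (x , y) → a ≤ x × suc x < y × y ≤ a + width t
    diagonal-range (node ds) a (node _ al) p = diagonal*-range ds a al p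

    diagonal*-range : ∀ ds a {x y} → All (Full j) ds → Diagonal* ds a (x , y) →
      a ≤ x × suc x < y × y ≤ a + width* ds
    diagonal*-range (leaf ∷ ds) a (v ∷ vs) (inj₁ (() , _))
    diagonal*-range (node ds' ∷ ds) a (v ∷ vs) (inj₁ (_ , refl)) = ≤-refl ,
        2+a≤a+n a (width* ds') (width-node≥2 ds' v) , a+width≤ a (node ds') ds
    diagonal*-range (d ∷ ds) a (v ∷ vs) (inj₂ (inj₁ p)) with diagonal-range d a v p
    ... | h1 , h2 , h3 = h1 , h2 , ≤-trans h3 (a+width≤ a d ds)
    diagonal*-range (d ∷ ds) a {x} {y} (v ∷ vs) (inj₂ (inj₂ p)) with diagonal*-range ds (a + width d) vs p
    ... | h1 , h2 , h3 = ≤-trans (m≤m+n a (width d)) h1 , h2 ,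
        subst (λ z → y ≤ z) (+-assoc a (width d) (width* ds)) h3

  diagonal*-< : ∀ ds a {x y} → All (Full j) ds → Diagonal* ds a (x , y) → x < y
  diagonal*-< ds a al p = <-trans (n<1+n _) (proj₁ (proj₂ (diagonal*-range ds a al p)))

  diagonal*-not-closing : ∀ ds a {x y} → Full j (node ds) → Diagonal* ds a (x , y) →
    ¬ (x ≡ a × y ≡ a + width* ds)
  diagonal*-not-closing (d ∷ d' ∷ ds) a (node _ (v ∷ v' ∷ vs)) p (refl , refl) = go p
    where
    lt : a + width d < a + width* (d ∷ d' ∷ ds)
    lt = +-monoʳ-< a (m<m+n (width d) (≤-trans (width-positive d' v') (m≤m+n _ _)))
    go : Diagonal* (d ∷ d' ∷ ds) a (a , a + width* (d ∷ d' ∷ ds)) → ⊥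
    go (inj₁ (_ , e)) = <-irrefl (sym (proj₂ (,-injective e))) lt
    go (inj₂ (inj₁ q)) = <-irrefl refl (<-≤-trans lt (proj₂ (proj₂ (diagonal-range d a v q))))
    go (inj₂ (inj₂ q)) = <-irrefl refl
        (<-≤-trans (a<a+width a d v) (proj₁ (diagonal*-range (d' ∷ ds) (a + width d) (v' ∷ vs) q)))
  diagonal*-not-closing [] a (node () _) p
  diagonal*-not-closing (d ∷ []) a (node () _) p

  diagonal-not-closing : ∀ t a {x y} → Full j t → Diagonal t a (x , y) → ¬ (x ≡ a × y ≡ a + width t)
  diagonal-not-closing (node ds) a v p = diagonal*-not-closing ds a v p

  noncrossing-disjoint : ∀ {x y x' y' m} → y ≤ m → m ≤ x' → x < y →
    ¬ Cross (x , y) (x' , y') × ¬ Cross (x' , y') (x , y)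
  noncrossing-disjoint ym mx xy = (λ { (inj₁ (_ , x'y , _)) → <-irrefl refl (<-≤-trans x'y (≤-trans ym mx))
                        ; (inj₂ (x'x , _ , _)) → <-irrefl refl
                            (<-≤-trans (<-trans x'x xy) (≤-trans ym mx)) }) ,
                     (λ { (inj₁ (x'x , _ , _)) → <-irrefl refl (<-≤-trans (<-trans x'x xy) (≤-trans ym mx))
                        ; (inj₂ (_ , x'y , _)) → <-irrefl refl (<-≤-trans x'y (≤-trans ym mx)) })

  noncrossing-nested : ∀ {c d x' y'} → c ≤ x' → y' ≤ d → ¬ Cross (c , d) (x' , y') × ¬ Cross (x' , y') (c , d)
  noncrossing-nested cx yd = (λ { (inj₁ (_ , _ , dy)) → <-irrefl refl (<-≤-trans dy yd)
                   ; (inj₂ (xc , _ , _)) → <-irrefl refl (<-≤-trans xc cx) }) ,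
                (λ { (inj₁ (xc , _ , _)) → <-irrefl refl (<-≤-trans xc cx)
                   ; (inj₂ (_ , _ , dy)) → <-irrefl refl (<-≤-trans dy yd) })

  noncrossing-self : ∀ e → ¬ Cross e e
  noncrossing-self e (inj₁ (lt , _)) = <-irrefl refl lt
  noncrossing-self e (inj₂ (lt , _)) = <-irrefl refl lt

  mutual
    diagonal-noncrossing : ∀ t a → Full j t → ∀ e f → Diagonal t a e → Diagonal t a f → ¬ Cross e f
    diagonal-noncrossing (node ds) a (node _ al) = diagonal*-noncrossing ds a al

    diagonal*-noncrossing : ∀ ds a → All (Full j) ds → ∀ e f → Diagonal* ds a e → Diagonal* ds a f →
      ¬ Cross e f
    diagonal*-noncrossing (d ∷ ds) a (v ∷ vs) e f (inj₁ (_ , refl)) (inj₁ (_ , refl)) = noncrossing-self e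
    diagonal*-noncrossing (d ∷ ds) a (v ∷ vs) e (x' , y') (inj₁ (_ , refl)) (inj₂ (inj₁ q)) =
      proj₁ (noncrossing-nested (proj₁ (diagonal-range d a v q)) (proj₂ (proj₂ (diagonal-range d a v q))))
    diagonal*-noncrossing (d ∷ ds) a (v ∷ vs) (x , y) f (inj₂ (inj₁ p)) (inj₁ (_ , refl)) =
      proj₂ (noncrossing-nested (proj₁ (diagonal-range d a v p)) (proj₂ (proj₂ (diagonal-range d a v p))))
    diagonal*-noncrossing (d ∷ ds) a (v ∷ vs) e (x' , y') (inj₁ (_ , refl)) (inj₂ (inj₂ q)) =
      proj₁ (noncrossing-disjoint ≤-refl (proj₁ (diagonal*-range ds _ vs q)) (a<a+width a d v))
    diagonal*-noncrossing (d ∷ ds) a (v ∷ vs) (x , y) f (inj₂ (inj₂ p)) (inj₁ (_ , refl)) =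
      proj₂ (noncrossing-disjoint ≤-refl (proj₁ (diagonal*-range ds _ vs p)) (a<a+width a d v))
    diagonal*-noncrossing (d ∷ ds) a (v ∷ vs) e f (inj₂ (inj₁ p))
        (inj₂ (inj₁ q)) = diagonal-noncrossing d a v e f p q
    diagonal*-noncrossing (d ∷ ds) a (v ∷ vs) (x , y) (x' , y') (inj₂ (inj₁ p)) (inj₂ (inj₂ q)) =
      proj₁ (noncrossing-disjoint (proj₂ (proj₂ (diagonal-range d a v p)))
          (proj₁ (diagonal*-range ds _ vs q)) (<-trans (n<1+n x) (proj₁ (proj₂ (diagonal-range d a v p)))))
    diagonal*-noncrossing (d ∷ ds) a (v ∷ vs) (x , y) (x' , y') (inj₂ (inj₂ p)) (inj₂ (inj₁ q)) =
      proj₂ (noncrossing-disjoint (proj₂ (proj₂ (diagonal-range d a v q)))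
          (proj₁ (diagonal*-range ds _ vs p)) (<-trans (n<1+n x') (proj₁ (proj₂ (diagonal-range d a v q)))))
    diagonal*-noncrossing (d ∷ ds) a (v ∷ vs) e f (inj₂ (inj₂ p))
        (inj₂ (inj₂ q)) = diagonal*-noncrossing ds _ vs e f p q

  Segment : List Tree → ℕ → ℕ → ℕ → Set
  Segment [] a c d = ⊥
  Segment (t ∷ ds) a c d = (c ≡ a × d ≡ a + width t) ⊎ Segment ds (a + width t) c d

  corners-sorted : ∀ ds a → All (Full j) ds → Linked _<_ (a ∷ corners ds a)
  corners-sorted [] a [] = [-]
  corners-sorted (d ∷ ds) a (v ∷ vs) = a<a+width a d v ∷ corners-sorted ds (a + width d) vs

  corners-last : ∀ ds a → lastOf a (corners ds a) ≡ a + width* ds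
  corners-last [] a = sym (+-identityʳ a)
  corners-last (d ∷ ds) a = trans (corners-last ds (a + width d)) (+-assoc a (width d) (width* ds))

  length-corners : ∀ ds a → length (corners ds a) ≡ length ds
  length-corners [] a = refl
  length-corners (d ∷ ds) a = cong suc (length-corners ds _)

  corners-above : ∀ ds a {q} → All (Full j) ds → q ∈ corners ds a → a < q
  corners-above (d ∷ ds) a (v ∷ vs) (here refl) = a<a+width a d v
  corners-above (d ∷ ds) a (v ∷ vs) (there p) = <-trans (a<a+width a d v) (corners-above ds _ vs p)

  segment-≥ : ∀ ds a {c d} → Segment ds a c d → a ≤ c
  segment-≥ (t ∷ ds) a (inj₁ (refl , _)) = ≤-refl
  segment-≥ (t ∷ ds) a (inj₂ s) = ≤-trans (m≤m+n a (width t)) (segment-≥ ds _ s)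

  segment⇒consecutive : ∀ ds a {c d} → All (Full j) ds → Segment ds a c d → Consecutive (a ∷ corners ds a) c d
  segment⇒consecutive (t ∷ ds) a (v ∷ vs) (inj₁ (refl , refl)) = here refl , there (here refl) ,
      a<a+width a t v , nb
    where
    nb : ∀ q → q ∈ a ∷ corners (t ∷ ds) a → ¬ (a < q × q < a + width t)
    nb q (here refl) (lt , _) = <-irrefl refl lt
    nb q (there (here refl)) (_ , lt) = <-irrefl refl lt
    nb q (there (there p)) (_ , lt) = <-asym lt (corners-above ds _ vs p)
  segment⇒consecutive (t ∷ ds) a (v ∷ vs) (inj₂ s) with segment⇒consecutive ds (a + width t) vs s
  ... | cm , dm , cd , nb = there cm , there dm , cd , nb'
    where
    nb' : ∀ q → q ∈ a ∷ corners (t ∷ ds) a → ¬ (_ < q × q < _)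
    nb' q (here refl) (cq , _) = <-asym cq (<-≤-trans (a<a+width a t v) (segment-≥ ds _ s))
    nb' q (there p) = nb q p

  ∈-tail : ∀ {x a : ℕ} {L} → x ∈ a ∷ L → a < x → x ∈ L
  ∈-tail (here refl) lt = ⊥-elim (<-irrefl refl lt)
  ∈-tail (there p) lt = p

  consecutive⇒segment : ∀ ds a {c d} → All (Full j) ds → Consecutive (a ∷ corners ds a) c d → Segment ds a c d
  consecutive⇒segment [] a [] (here refl , here refl , cd , _) = ⊥-elim (<-irrefl refl cd)
  consecutive⇒segment [] a [] (here refl , there () , cd , _)
  consecutive⇒segment [] a [] (there () , _ , cd , _)
  consecutive⇒segment (t ∷ ds) a (v ∷ vs) (here refl , here refl , cd , nb) = ⊥-elim (<-irrefl refl cd)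
  consecutive⇒segment (t ∷ ds) a (v ∷ vs) (here refl , there (here refl) , cd , nb) = inj₁ (refl , refl)
  consecutive⇒segment (t ∷ ds) a (v ∷ vs) (here refl , there (there dm) , cd , nb) =
    ⊥-elim (nb (a + width t) (there (here refl)) (a<a+width a t v , corners-above ds _ vs dm))
  consecutive⇒segment (t ∷ ds) a (v ∷ vs) (there cm , dm , cd , nb) = inj₂
      (consecutive⇒segment ds (a + width t) vs (cm , dm' , cd , λ q p → nb q (there p)))
    where
    ac : a + width t ≤ _
    ac = head-≤ (corners-sorted ds (a + width t) vs) cm
    dm' : _ ∈ (a + width t) ∷ corners ds (a + width t)
    dm' = ∈-tail dm (<-trans (<-≤-trans (a<a+width a t v) ac) cd)

  segment-containing : ∀ ds a x → All (Full j) ds → a ≤ x → x < a + width* ds → Σ ℕ λ c → Σ ℕ λ d →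
    Segment ds a c d × c ≤ x × x < d
  segment-containing [] a x [] ax xa = ⊥-elim
      (<-irrefl refl (<-≤-trans xa (subst (_≤ x) (sym (+-identityʳ a)) ax)))
  segment-containing (t ∷ ds) a x (v ∷ vs) ax xa with x <? a + width t
  ... | yes lt = a , a + width t , inj₁ (refl , refl) , ax , lt
  ... | no nlt with segment-containing ds (a + width t) x vs (≮⇒≥ nlt)
      (subst (x <_) (sym (+-assoc a (width t) (width* ds))) xa)
  ...   | c , d , s , cx , xd = c , d , inj₂ s , cx , xd

  diagonal*-segment : ∀ ds a {x y} → All (Full j) ds → Diagonal* ds a (x , y) → Σ ℕ λ c → Σ ℕ λ d →
    Segment ds a c d × c ≤ x × y ≤ d
  diagonal*-segment (t ∷ ds) a (v ∷ vs) (inj₁ (_ , refl)) = a , a + width t , inj₁ (refl , refl) ,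
      ≤-refl , ≤-refl
  diagonal*-segment (t ∷ ds) a (v ∷ vs) (inj₂ (inj₁ p)) = a , a + width t , inj₁ (refl , refl) ,
      proj₁ (diagonal-range t a v p) , proj₂ (proj₂ (diagonal-range t a v p))
  diagonal*-segment (t ∷ ds) a (v ∷ vs) (inj₂ (inj₂ p)) with diagonal*-segment ds (a + width t) vs p
  ... | c , d , s , cx , yd = c , d , inj₂ s , cx , yd

  segment-subtree : ∀ ds a {c d} → All (Full j) ds → Segment ds a c d → Σ Tree λ t' →
    Full j t' × d ≡ c + width t' × #internal t' ≤ #internal* ds ×
    (∀ x y → c ≤ x → y ≤ d → x < y → Diagonal* ds a (x , y) → (x ≡ c × y ≡ d) ⊎ Diagonal t' c (x , y)) ×
    (∀ e → Diagonal t' c e → Diagonal* ds a e) × (IsNode t' → Diagonal* ds a (c , d))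
  segment-subtree (t ∷ ds) a (v ∷ vs) (inj₁ (refl , refl)) = t , v , refl ,
      m≤m+n (#internal t) (#internal* ds) , conv , (λ e p → inj₂ (inj₁ p)) , (λ p → inj₁ (p , refl))
    where
    conv : ∀ x y → a ≤ x → y ≤ a + width t → x < y → Diagonal* (t ∷ ds) a (x , y) →
      (x ≡ a × y ≡ a + width t) ⊎ Diagonal t a (x , y)
    conv x y _ _ _ (inj₁ (_ , refl)) = inj₁ (refl , refl)
    conv x y _ _ _ (inj₂ (inj₁ p)) = inj₂ p
    conv x y _ yd xy (inj₂ (inj₂ p)) = ⊥-elim
        (<-irrefl refl (<-≤-trans (<-≤-trans xy yd) (proj₁ (diagonal*-range ds _ vs p))))
  segment-subtree (t ∷ ds) a {c} {d} (v ∷ vs) (inj₂ s) with segment-subtree ds (a + width t) vs s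
  ... | t' , v' , e , sz , conv , sub , root = t' , v' , e ,
      ≤-trans sz (m≤n+m (#internal* ds) (#internal t)) , conv' , (λ e p → inj₂ (inj₂ (sub e p))) ,
      (λ p → inj₂ (inj₂ (root p)))
    where
    ac = segment-≥ ds (a + width t) s
    conv' : ∀ x y → c ≤ x → y ≤ d → x < y → Diagonal* (t ∷ ds) a (x , y) →
      (x ≡ c × y ≡ d) ⊎ Diagonal t' c (x , y)
    conv' x y cx yd xy (inj₁ (_ , refl)) = ⊥-elim
        (<-irrefl refl (<-≤-trans (a<a+width a t v) (≤-trans ac cx)))
    conv' x y cx yd xy (inj₂ (inj₁ p)) = ⊥-elim
        (<-irrefl refl (<-≤-trans xy (≤-trans (proj₂ (proj₂ (diagonal-range t a v p))) (≤-trans ac cx))))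
    conv' x y cx yd xy (inj₂ (inj₂ p)) = conv x y cx yd xy p

  children-full : ∀ {ds} → Full j (node ds) → All (Full j) ds
  children-full (node _ al) = al

  children-length : ∀ {ds} → Full j (node ds) → length ds ≡ suc j
  children-length (node l _) = l

  module NodeFrame (ds : List Tree) (a : ℕ) (vt : Full j (node ds)) where
    al : All (Full j) ds
    al = children-full vt
    lends : length ds ≡ suc j
    lends = children-length vt
    b : ℕ
    b = a + width* ds
    srtQ : Linked _<_ (a ∷ corners ds a)
    srtQ = corners-sorted ds a al
    lastQ : lastOf a (corners ds a) ≡ b
    lastQ = corners-last ds a
    lenQ : 3 ≤ length (a ∷ corners ds a)
    lenQ = subst (3 ≤_) (sym (cong suc (trans (length-corners ds a) lends))) (s≤s (s≤s (s≤s z≤n)))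

    frame-edge : ∀ x y → a ≤ x → y ≤ b → x < y → EdgeOf a b (Diagonal* ds a) x y →
      FrameEdge a b (a ∷ corners ds a) x y
    frame-edge x y ax yb xy (inj₁ (inj₁ refl)) with segment-containing ds a x al ax yb
    ... | c , d , s , cx , xd = inj₂ (inj₂ (c , d , segment⇒consecutive ds a al s , cx , xd))
    frame-edge x y ax yb xy (inj₁ (inj₂ e)) = inj₁ e
    frame-edge x y ax yb xy (inj₂ p) with diagonal*-segment ds a al p
    ... | c , d , s , cx , yd = inj₂ (inj₂ (c , d , segment⇒consecutive ds a al s , cx , yd))

    frame-consecutive-edge : ∀ c d → Consecutive (a ∷ corners ds a) c d → EdgeOf a b (Diagonal* ds a) c d
    frame-consecutive-edge c d adj with segment-subtree ds a al (consecutive⇒segment ds a al adj)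
    ... | leaf , _ , e , _ , _ , _ , _ = inj₁ (inj₁ (trans e (+-comm c 1)))
    ... | node _ , _ , e , _ , _ , _ , root = inj₂ (root tt)

    open Frame {a} {b} {Diagonal* ds a} {corners ds a} srtQ lastQ lenQ frame-edge frame-consecutive-edge
      public hiding (Q)

    regQ : RegionOf a b (Diagonal* ds a) (a ∷ corners ds a)
    regQ = frame-region (λ x y p → diagonal*-< ds a al p)
        (λ p → diagonal*-not-closing ds a vt p (refl , refl))

    consecutive-not-closing : ∀ {c d} → Consecutive (a ∷ corners ds a) c d → ¬ (c ≡ a × d ≡ b)
    consecutive-not-closing (_ , _ , _ , nb) (refl , refl) with middle-vertex srtQ lenQ
    ... | m , mm , am , mb = nb m mm (am , subst (m <_) lastQ mb)

  region-length : ∀ f t a S → #internal t < f → Full j t → RegionOf a (a + width t) (Diagonal t a) S →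
    length S ≡ suc (suc j)
  region-length f t a [] _ _ (region _ () _ _ _)
  region-length f leaf a (s0 ∷ S') _ _ R with middle-vertex (RegionOf.sorted R) (RegionOf.size≥3 R)
  ... | m , mm , s0m , msl = ⊥-elim
      (<-irrefl refl (<-≤-trans (≤-<-trans as0 s0m)
      (≤-pred (<-≤-trans msl (subst (lastOf s0 S' ≤_) (+-comm a 1) sla)))))
    where
    as0 : a ≤ s0
    as0 = proj₁ (RegionOf.bounded R s0 (here refl))
    sla : lastOf s0 S' ≤ a + 1
    sla = proj₂ (RegionOf.bounded R (lastOf s0 S') (lastOf-∈ s0 S'))
  region-length (suc f) (node ds) a (s0 ∷ S') (s≤s sz) vt R with NodeFrame.classify-region ds a vt R
  ... | inj₁ e = trans (cong length e) (cong suc (trans (length-corners ds a) (children-length vt)))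
  ... | inj₂ (c , d , adj , inS) with segment-subtree ds a (children-full vt)
      (consecutive⇒segment ds a (children-full vt) adj)
  ...   | t' , v' , ed , szt , conv , sub , root =
          region-length f t' c (s0 ∷ S') (≤-<-trans szt sz) v'
            (subst (λ z → RegionOf c z (Diagonal t' c) (s0 ∷ S')) ed
              (region-restrict R inS (proj₁ (NodeFrame.frame-range ds a vt (proj₁ adj)))
                  (proj₂ (NodeFrame.frame-range ds a vt (proj₁ (proj₂ adj))))
                (NodeFrame.consecutive-not-closing ds a vt adj) conv' sub))
    where
    conv' : ∀ x y → c ≤ x → y ≤ d → x < y → Diagonal* ds a (x , y) → SideOf c d x y ⊎ Diagonal t' c (x , y)
    conv' x y cx yd xy p with conv x y cx yd xy p
    ... | inj₁ e = inj₁ (inj₂ e)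
    ... | inj₂ q = inj₂ q

  diagonal*-first : ∀ d ds a {x y} → Full j d → All (Full j) ds → Diagonal* (d ∷ ds) a (x , y) →
    y ≤ a + width d → ¬ (x ≡ a × y ≡ a + width d) → Diagonal d a (x , y)
  diagonal*-first d ds a v vs (inj₁ (_ , refl)) yd n = ⊥-elim (n (refl , refl))
  diagonal*-first d ds a v vs (inj₂ (inj₁ p)) yd n = p
  diagonal*-first d ds a v vs (inj₂ (inj₂ p)) yd n =
    ⊥-elim (<-irrefl refl (<-≤-trans (<-≤-trans (diagonal*-< ds _ vs p) yd)
        (proj₁ (diagonal*-range ds _ vs p))))

  mutual
    diagonal-injective : ∀ t t' a → Full j t → Full j t' → width t ≡ width t' →
      (∀ e → Diagonal t a e → Diagonal t' a e) → (∀ e → Diagonal t' a e → Diagonal t a e) → t ≡ t'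
    diagonal-injective leaf leaf a _ _ _ _ _ = refl
    diagonal-injective leaf (node ds') a _ v' e _ _ = ⊥-elim (<-irrefl e (width-node≥2 ds' v'))
    diagonal-injective (node ds) leaf a v _ e _ _ = ⊥-elim (<-irrefl (sym e) (width-node≥2 ds v))
    diagonal-injective (node ds) (node ds') a v v' e f g with NodeFrame.classify-region ds' a v' R'
      where
      R' : RegionOf a (a + width* ds') (Diagonal* ds' a) (a ∷ corners ds a)
      R' = subst (λ z → RegionOf a (a + z) (Diagonal* ds' a) (a ∷ corners ds a)) e
          (region-cong (NodeFrame.regQ ds a v) f g)
    ... | inj₁ eq = cong node
        (diagonal*-injective ds ds' a (children-full v) (children-full v') (∷-injectiveʳ eq) f g)
    ... | inj₂ (c , d , adj , inS) = ⊥-elim (NodeFrame.consecutive-not-closing ds' a v' adj (ca , db))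
      where
      ca : c ≡ a
      ca = ≤-antisym (proj₁ (inS a (here refl))) (proj₁ (NodeFrame.frame-range ds' a v' (proj₁ adj)))
      db : d ≡ a + width* ds'
      db = ≤-antisym (proj₂ (NodeFrame.frame-range ds' a v' (proj₁ (proj₂ adj))))
             (subst (_≤ d) (cong (a +_) e) (proj₂ (inS (a + width* ds) (NodeFrame.b∈Q ds a v))))

    diagonal*-injective : ∀ ds ds' a → All (Full j) ds → All (Full j) ds' → corners ds a ≡ corners ds' a →
      (∀ e → Diagonal* ds a e → Diagonal* ds' a e) → (∀ e → Diagonal* ds' a e → Diagonal* ds a e) → ds ≡ ds'
    diagonal*-injective [] [] a _ _ _ _ _ = refl
    diagonal*-injective [] (_ ∷ _) a _ _ () _ _
    diagonal*-injective (_ ∷ _) [] a _ _ () _ _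
    diagonal*-injective (d ∷ ds) (d' ∷ ds') a (v ∷ vs) (v' ∷ vs') eP f g with ∷-injective eP
    ... | e1 , e2 = cong₂ _∷_ (diagonal-injective d d' a v v' wdd fc gc)
        (diagonal*-injective ds ds' (a + width d) vs vs' (trans e2 (cong (corners ds') (sym e1))) ft gt)
      where
      wdd : width d ≡ width d'
      wdd = +-cancelˡ-≡ a (width d) (width d') e1
      fc : ∀ e → Diagonal d a e → Diagonal d' a e
      fc (x , y) p = diagonal*-first d' ds' a v' vs' (f _ (inj₂ (inj₁ p)))
          (subst (y ≤_) e1 (proj₂ (proj₂ (diagonal-range d a v p))))
                       (λ { (ex , ey) → diagonal-not-closing d a v p (ex , trans ey (sym e1)) })
      gc : ∀ e → Diagonal d' a e → Diagonal d a e
      gc (x , y) p = diagonal*-first d ds a v vs (g _ (inj₂ (inj₁ p)))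
          (subst (y ≤_) (sym e1) (proj₂ (proj₂ (diagonal-range d' a v' p))))
                       (λ { (ex , ey) → diagonal-not-closing d' a v' p (ex , trans ey e1) })
      ft : ∀ e → Diagonal* ds (a + width d) e → Diagonal* ds' (a + width d) e
      ft (x , y) p = subst (λ z → Diagonal* ds' z (x , y)) (sym e1)
          (diagonal*-rest d' ds' a v' vs' (f _ (inj₂ (inj₂ p)))
          (subst (_≤ x) e1 (proj₁ (diagonal*-range ds _ vs p))))
      gt : ∀ e → Diagonal* ds' (a + width d) e → Diagonal* ds (a + width d) e
      gt (x , y) p = diagonal*-rest d ds a v vs (g _ (inj₂ (inj₂ p′)))
          (subst (_≤ x) (sym e1) (proj₁ (diagonal*-range ds' _ vs' p′)))
        where
        p′ : Diagonal* ds' (a + width d') (x , y)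
        p′ = subst (λ z → Diagonal* ds' z (x , y)) e1 p

    diagonal*-rest : ∀ d ds a {x y} → Full j d → All (Full j) ds → Diagonal* (d ∷ ds) a (x , y) →
      a + width d ≤ x → Diagonal* ds (a + width d) (x , y)
    diagonal*-rest d ds a v vs (inj₁ (_ , refl)) le = ⊥-elim (<-irrefl refl (<-≤-trans (a<a+width a d v) le))
    diagonal*-rest d ds a v vs (inj₂ (inj₁ p)) le =
      ⊥-elim (<-irrefl refl (<-≤-trans (<-trans (n<1+n _) (proj₁ (proj₂ (diagonal-range d a v p))))
          (≤-trans (proj₂ (proj₂ (diagonal-range d a v p))) le)))
    diagonal*-rest d ds a v vs (inj₂ (inj₂ p)) le = p

  record Angulated (a b : ℕ) (Δ : ℕ × ℕ → Set) : Set₁ where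
    field
      decidable : ∀ e → Dec (Δ e)
      in-range : ∀ x y → Δ (x , y) → a ≤ x × suc x < y × y ≤ b × ¬ (x ≡ a × y ≡ b)
      noncrossing : ∀ e f → Δ e → Δ f → ¬ Cross e f
      region-size : ∀ S → RegionOf a b Δ S → length S ≡ suc (suc j)

  TreeOf : ℕ → ℕ → (ℕ × ℕ → Set) → Set
  TreeOf a b Δ = Σ Tree λ t →
      Full j t × a + width t ≡ b × (∀ e → Δ e → Diagonal t a e) × (∀ e → Diagonal t a e → Δ e)

  module Construct (a b : ℕ) (Δ : ℕ × ℕ → Set) (H : Angulated a b Δ) (a+1<b : suc a < b)
    (rec : ∀ c d → a ≤ c → d ≤ b → c < d → ¬ (c ≡ a × d ≡ b) → (Δ′ : ℕ × ℕ → Set) → Angulated c d Δ′ →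
        TreeOf c d Δ′) where
    open Angulated H

    ShortEdge : ℕ → ℕ → Set
    ShortEdge x y = (y ≡ suc x ⊎ Δ (x , y)) × ¬ (x ≡ a × y ≡ b)

    shortEdge? : ∀ x y → Dec (ShortEdge x y)
    shortEdge? x y = ((y ≟ suc x) ⊎-dec decidable (x , y)) ×-dec ¬? ((x ≟ a) ×-dec (y ≟ b))

    farthest : ℕ → ℕ → ℕ
    farthest x zero = suc x
    farthest x (suc y) with x <? suc y | shortEdge? x (suc y)
    ... | yes _ | yes _ = suc y
    ... | _ | _ = farthest x y

    farthest-spec : ∀ x y → suc x ≤ y → ShortEdge x (suc x) →
      x < farthest x y × farthest x y ≤ y × ShortEdge x (farthest x y) ×
      (∀ z → farthest x y < z → z ≤ y → ¬ ShortEdge x z)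
    farthest-spec x (suc y) le ok with x <? suc y | shortEdge? x (suc y)
    ... | yes p | yes o = p , ≤-refl , o , (λ z lt zle _ → <-irrefl refl (<-≤-trans lt zle))
    ... | no np | _ = ⊥-elim (np le)
    ... | yes p | no no' with suc x ≤? y
    ...   | yes le' with farthest-spec x y le' ok
    ...     | a1 , a2 , a3 , a4 = a1 , ≤-trans a2 (n≤1+n y) , a3 , mx
      where
      mx : ∀ z → farthest x y < z → z ≤ suc y → ¬ ShortEdge x z
      mx z lt zle with z ≟ suc y
      ... | yes refl = no'
      ... | no ne = a4 z lt (≤-pred (≤∧≢⇒< zle ne))
    farthest-spec x (suc y) le ok | yes p | no no' | no nle = ⊥-elim
        (no' (subst (ShortEdge x) (cong suc yx) ok))
      where
      yx : x ≡ y
      yx = ≤-antisym (≤-pred le) (≮⇒≥ (λ lt → nle lt))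

    shortEdge-suc : ∀ x → ShortEdge x (suc x)
    shortEdge-suc x = inj₁ refl , λ { (refl , refl) → <-irrefl refl a+1<b }

    next : ℕ → ℕ
    next x = farthest x b

    next-spec : ∀ x → x < b →
      x < next x × next x ≤ b × ShortEdge x (next x) × (∀ z → next x < z → z ≤ b → ¬ ShortEdge x z)
    next-spec x xb = farthest-spec x b xb (shortEdge-suc x)

    data Path : ℕ → List ℕ → Set where
      end : ∀ {q} → q ≡ b → Path q []
      step : ∀ {q q' L} → q < b → q' ≡ next q → Path q' L → Path q (q' ∷ L)

    path : ∀ f q → q ≤ b → b ≤ q + f → Σ (List ℕ) (Path q)
    path f q qb bf with q ≟ b
    ... | yes refl = [] , end refl
    path zero q qb bf | no ne = ⊥-elim (ne (≤-antisym qb (subst (b ≤_) (+-identityʳ q) bf)))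
    path (suc f) q qb bf | no ne with next-spec q (≤∧≢⇒< qb ne)
    ... | s1 , s2 , _ , _ with path f (next q) s2
        (≤-trans bf (subst (_≤ next q + f) (sym (+-suc q f)) (+-monoˡ-≤ f s1)))
    ...   | L , c = next q ∷ L , step (≤∧≢⇒< qb ne) refl c

    path-sorted : ∀ {q L} → Path q L → Linked _<_ (q ∷ L)
    path-sorted (end refl) = [-]
    path-sorted (step lt refl c) = proj₁ (next-spec _ lt) ∷ path-sorted c

    path-last : ∀ {q L} → Path q L → lastOf q L ≡ b
    path-last (end refl) = refl
    path-last (step lt refl c) = path-last c

    path-range : ∀ {q L z} → Path q L → z ∈ q ∷ L → q ≤ z × z ≤ b
    path-range c p = head-≤ (path-sorted c) p , subst (_ ≤_) (path-last c) (≤-lastOf (path-sorted c) p)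

    path-next∈ : ∀ {q L x} → Path q L → x ∈ q ∷ L → x < b → next x ∈ q ∷ L
    path-next∈ (end refl) (here refl) xb = ⊥-elim (<-irrefl refl xb)
    path-next∈ (step lt refl c) (here refl) xb = there (here refl)
    path-next∈ (step lt refl c) (there p) xb = there (path-next∈ c p xb)

    path-next-≤ : ∀ {q L x z} → Path q L → x ∈ q ∷ L → z ∈ q ∷ L → x < z → next x ≤ z
    path-next-≤ (end refl) (here refl) (here refl) lt = ⊥-elim (<-irrefl refl lt)
    path-next-≤ (step lt refl c) (here refl) (here refl) xz = ⊥-elim (<-irrefl refl xz)
    path-next-≤ (step lt refl c) (here refl) (there p) xz = head-≤ (path-sorted c) p
    path-next-≤ (step lt refl c) (there p) (here refl) xz = ⊥-elim
        (<-asym xz (<-≤-trans (proj₁ (next-spec _ lt)) (head-≤ (path-sorted c) p)))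
    path-next-≤ (step lt refl c) (there p) (there q) xz = path-next-≤ c p q xz

    path-consecutive : ∀ {q L x y} → Path q L → Consecutive (q ∷ L) x y → y ≡ next x
    path-consecutive {x = x} {y} c (xm , ym , xy , nb) = go (<-≤-trans xy (proj₂ (path-range c ym)))
      where
      go : x < b → y ≡ next x
      go xb with <-cmp (next x) y
      ... | tri≈ _ e _ = sym e
      ... | tri< lt _ _ = ⊥-elim (nb (next x) (path-next∈ c xm xb) (proj₁ (next-spec x xb) , lt))
      ... | tri> _ _ gt = ⊥-elim (<-irrefl refl (<-≤-trans gt (path-next-≤ c xm ym xy)))

    path-length : ∀ {q L} → Path q L → q < b → next q < b → 2 ≤ length L
    path-length (end refl) qb _ = ⊥-elim (<-irrefl refl qb)
    path-length (step lt refl (end e)) _ nb = ⊥-elim (<-irrefl e nb)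
    path-length (step lt refl (step lt' refl c)) _ _ = s≤s (s≤s z≤n)

    a<b : a < b
    a<b = <-trans (n<1+n a) a+1<b

    next-a<b : next a < b
    next-a<b with next-spec a a<b
    ... | _ , le , (_ , nab) , _ = ≤∧≢⇒< le (λ e → nab (refl , e))

    shortEdge⇒edge : ∀ {x y} → ShortEdge x y → EdgeOf a b Δ x y
    shortEdge⇒edge (inj₁ e , _) = inj₁ (inj₁ e)
    shortEdge⇒edge (inj₂ dp , _) = inj₂ dp

    Inside : ℕ → ℕ → ℕ × ℕ → Set
    Inside q q′ (x , y) = Δ (x , y) × (q ≤ x × y ≤ q′) × (x , y) ≢ (q , q′)

    angulated-inside : ∀ q q′ → a ≤ q → q′ ≤ b → ShortEdge q q′ → Angulated q q′ (Inside q q′)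
    angulated-inside q q′ aq q′b short = record
      { decidable = λ { (x , y) →
          decidable (x , y) ×-dec (((q ≤? x) ×-dec (y ≤? q′)) ×-dec ¬? ((x , y) ≟ₚ (q , q′))) }
      ; in-range = λ { x y (dp , (qx , yq′) , ne) →
          qx , proj₁ (proj₂ (in-range x y dp)) , yq′ , (λ { (refl , refl) → ne refl }) }
      ; noncrossing = λ { e f p p′ → noncrossing e f (proj₁ p) (proj₁ p′) }
      ; region-size = λ S R → region-size S
          (region-lift R (shortEdge⇒edge short) (λ { (x , y) p → proj₁ p }) split aq q′b) }
      where
      split : ∀ x y → q ≤ x → y ≤ q′ → Δ (x , y) → (x ≡ q × y ≡ q′) ⊎ Inside q q′ (x , y)
      split x y qx yq′ dp with (x , y) ≟ₚ (q , q′)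
      ... | yes e = inj₁ (,-injective e)
      ... | no ne = inj₂ (dp , (qx , yq′) , ne)

    module RootRegion {L : List ℕ} (root-path : Path a L) where
      Q : List ℕ
      Q = a ∷ L

      b∈ : b ∈ Q
      b∈ = subst (_∈ Q) (path-last root-path) (lastOf-∈ a L)

      regQ : RegionOf a b Δ Q
      regQ = region (path-sorted root-path) (s≤s (path-length root-path a<b next-a<b))
                    (λ v p → path-range root-path p) cons diag
        where
        cons : ∀ x y → x ∈ Q → y ∈ Q → x < y → ConsecIn Q x y → EdgeOf a b Δ x y
        cons x y xm ym xy (inj₁ nb) with path-consecutive root-path (xm , ym , xy , nb)
        ... | refl = shortEdge⇒edge
            (proj₁ (proj₂ (proj₂ (next-spec x (<-≤-trans xy (proj₂ (path-range root-path ym)))))))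
        cons x y xm ym xy (inj₂ g) = inj₁
            (inj₂ (≤-antisym (proj₁ (g a (here refl))) (proj₁ (path-range root-path xm)) ,
                                                 ≤-antisym (proj₂ (path-range root-path ym)) (proj₂ (g b b∈))))
        diag : ∀ x y → x ∈ Q → y ∈ Q → Δ (x , y) → ConsecIn Q x y
        diag x y xm ym dp with in-range x y dp
        ... | ax , sxy , yb , nab with next-spec x (<-≤-trans (<-trans (n<1+n x) sxy) yb)
        ...   | xn , nb' , okn , mx with <-cmp (next x) y
        ...     | tri≈ _ refl _ = inj₁
            (λ z zm (xz , zn) → <-irrefl refl (<-≤-trans zn (path-next-≤ root-path xm zm xz)))
        ...     | tri< lt _ _ = ⊥-elim (mx y lt yb (inj₂ dp , nab))
        ...     | tri> _ _ gt = ⊥-elim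
            (<-irrefl refl (<-≤-trans gt (path-next-≤ root-path xm ym (<-trans (n<1+n x) sxy))))

      no-diagonal-across : ∀ q → q ∈ Q → ∀ x y → Δ (x , y) → x < q → q < y → ⊥
      no-diagonal-across q qm x y dp xq qy with in-range x y dp
      ... | ax , sxy , yb , nab with straddlingPair (suc x) (path-sorted root-path) (here refl) (s≤s ax) qm xq
      ...   | s , s' , sm , s'm , sx , xs' , nb
        with path-consecutive root-path (sm , s'm , <-≤-trans sx xs' , nb)
      ...     | refl with next-spec s (<-≤-trans (<-≤-trans sx xs') (proj₂ (path-range root-path s'm)))
      ...       | _ , _ , oks , mx = go (≤-pred sx)
        where
        s'q : next s ≤ q
        s'q = ≮⇒≥ (λ qs' → nb q qm (≤-<-trans (≤-pred sx) xq , qs'))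
        go : s ≤ x → ⊥
        go sx' with <-cmp s x
        ... | tri≈ _ refl _ = mx y (≤-<-trans s'q qy) yb (inj₂ dp , nab)
        ... | tri> _ _ gt = <-irrefl refl (<-≤-trans gt sx')
        ... | tri< lt _ _ with proj₁ oks
        ...   | inj₁ e = <-irrefl refl (<-≤-trans lt (≤-pred (subst (x <_) e xs')))
        ...   | inj₂ dp' = noncrossing (s , next s) (x , y) dp' dp (inj₁ (lt , xs' , ≤-<-trans s'q qy))

      node-not-side : ∀ {q q'} t → Full j t → IsNode t → q + width t ≡ q' → q' ≡ suc q → ⊥
      node-not-side {q} (node dd) v _ e e1 = <-irrefl refl
          (<-≤-trans (s≤s (≤-refl {suc q}))
          (subst (suc (suc q) ≤_) (trans e e1) (2+a≤a+n q (width* dd) (width-node≥2 dd v))))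

      wide⇒node : ∀ {q q'} t → q + width t ≡ q' → suc q < q' → IsNode t
      wide⇒node {q} leaf e lt = ⊥-elim (<-irrefl (trans (sym (+-comm q 1)) e) lt)
      wide⇒node (node _) e lt = tt

      subtrees : ∀ {q L} → Path q L → a ≤ q → (∀ z → z ∈ q ∷ L → z ∈ Q) →
        Σ (List Tree) λ ts → All (Full j) ts × corners ts q ≡ L × length ts ≡ length L ×
          (∀ x y → q ≤ x → Δ (x , y) → Diagonal* ts q (x , y)) × (∀ e → Diagonal* ts q e → Δ e)
      subtrees (end refl) aq sub = [] , [] , refl , refl ,
        (λ x y bx dp → ⊥-elim (<-irrefl refl
          (<-≤-trans (<-trans (n<1+n x) (proj₁ (proj₂ (in-range x y dp))))
                     (≤-trans (proj₁ (proj₂ (proj₂ (in-range x y dp)))) bx)))) ,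
        (λ e ())
      subtrees {q} (step q<b refl c) aq sub with next-spec q q<b
      ... | q<q′ , q′≤b , short , _
        with rec q (next q) aq q′≤b q<q′ (proj₂ short) (Inside q (next q))
            (angulated-inside q (next q) aq q′≤b short)
           | subtrees c (≤-trans aq (<⇒≤ q<q′)) (λ z p → sub z (there p))
      ... | t , full , width≡ , fwd-t , bwd-t | ts , fulls , corners≡ , length≡ , fwd-ts , bwd-ts =
        t ∷ ts , full ∷ fulls , cong₂ _∷_ width≡ (trans (cong (corners ts) width≡) corners≡) ,
            cong suc length≡ , fwd , bwd
        where
        fwd : ∀ x y → q ≤ x → Δ (x , y) → Diagonal* (t ∷ ts) q (x , y)
        fwd x y qx dp with y ≤? next q
        ... | yes yq′ with (x , y) ≟ₚ (q , next q)
        ...   | yes e with ,-injective e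
        ...     | refl , refl = inj₁
            (wide⇒node t width≡ (proj₁ (proj₂ (in-range x y dp))) , cong (q ,_) (sym width≡))
        fwd x y qx dp | yes yq′ | no ne = inj₂ (inj₁ (fwd-t (x , y) (dp , (qx , yq′) , ne)))
        fwd x y qx dp | no y≰q′ = inj₂
            (inj₂ (subst (λ z → Diagonal* ts z (x , y)) (sym width≡) (fwd-ts x y q′≤x dp)))
          where
          q′≤x : next q ≤ x
          q′≤x = ≮⇒≥ (λ x<q′ → no-diagonal-across (next q) (sub (next q) (there (here refl))) x y dp x<q′
              (≰⇒> y≰q′))
        bwd : ∀ e → Diagonal* (t ∷ ts) q e → Δ e
        bwd e (inj₁ (isNode , refl)) with proj₁ short
        ... | inj₂ dp = subst (λ z → Δ (q , z)) (sym width≡) dp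
        ... | inj₁ e1 = ⊥-elim (node-not-side t full isNode width≡ e1)
        bwd e (inj₂ (inj₁ p)) = proj₁ (bwd-t e p)
        bwd e (inj₂ (inj₂ p)) = bwd-ts e (subst (λ z → Diagonal* ts z e) width≡ p)

      root-tree : TreeOf a b Δ
      root-tree with subtrees root-path ≤-refl (λ z p → p)
      ... | ts , fulls , corners≡ , length≡ , fwd , bwd =
        node ts , node (trans length≡ (suc-injective (region-size Q regQ))) fulls ,
        trans (sym (corners-last ts a)) (trans (cong (lastOf a) corners≡) (path-last root-path)) ,
        (λ { (x , y) dp → fwd x y (proj₁ (in-range x y dp)) dp }) , bwd

    treeOf′ : ∀ f → b ≤ a + f → TreeOf a b Δ
    treeOf′ f bf = RootRegion.root-tree (proj₂ (path f a (<⇒≤ a<b) bf))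

  treeOf : ∀ f a b Δ → b ≤ a + f → a < b → Angulated a b Δ → TreeOf a b Δ
  treeOf zero a b Δ bf ab H = ⊥-elim (<-irrefl refl (<-≤-trans ab (subst (b ≤_) (+-identityʳ a) bf)))
  treeOf (suc f) a b Δ bf ab H with suc a ≟ b
  ... | yes refl = leaf , leaf , +-comm a 1 , (λ { (x , y) dp → ⊥-elim (noD x y dp) }) , (λ e ())
    where
    noD : ∀ x y → Δ (x , y) → ⊥
    noD x y dp with Angulated.in-range H x y dp
    ... | ax , sxy , yb , _ = <-irrefl refl (≤-trans (s≤s (s≤s ax)) (≤-trans sxy yb))
  ... | no ne = Construct.treeOf′ a b Δ H (≤∧≢⇒< ab ne) rec (suc f) bf
    where
    rec : ∀ c d → a ≤ c → d ≤ b → c < d → ¬ (c ≡ a × d ≡ b) → (Δ′ : ℕ × ℕ → Set) → Angulated c d Δ′ →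
      TreeOf c d Δ′
    rec c d ac db cd nab Δ′ H' = treeOf f c d Δ′ fuel cd H'
      where
      bf' : b ≤ suc (a + f)
      bf' = subst (b ≤_) (+-suc a f) bf
      fuel : d ≤ c + f
      fuel with c ≟ a
      ... | yes refl = ≤-pred (≤-trans (≤∧≢⇒< db (λ e → nab (refl , e))) bf')
      ... | no cna = ≤-trans db (≤-trans bf' (+-monoˡ-≤ f (≤∧≢⇒< ac (λ e → cna (sym e)))))

  private
    open +-*-Solver
    sum-of-widths : ∀ a b j l → (a * j + 1) + (b * j + l) ≡ (a + b) * j + suc l
    sum-of-widths = solve 4 (λ a b j l →
        (a :* j :+ con 1) :+ (b :* j :+ l) := (a :+ b) :* j :+ (con 1 :+ l)) refl
    node-width : ∀ s j → s * j + suc j ≡ suc s * j + 1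
    node-width = solve 2 (λ s j → s :* j :+ (con 1 :+ j) := (con 1 :+ s) :* j :+ con 1) refl

  mutual
    width-full : ∀ t → Full j t → width t ≡ #internal t * j + 1
    width-full leaf _ = refl
    width-full (node ds) (node len al) = trans (width*-full ds al)
        (trans (cong (#internal* ds * j +_) len) (node-width (#internal* ds) j))

    width*-full : ∀ ds → All (Full j) ds → width* ds ≡ #internal* ds * j + length ds
    width*-full [] [] = refl
    width*-full (d ∷ ds) (v ∷ vs) = trans (cong₂ _+_ (width-full d v) (width*-full ds vs))
        (sum-of-widths (#internal d) (#internal* ds) j (length ds))

  dissectionOf : ℕ → Tree → List (ℕ × ℕ)
  dissectionOf m t = filter (diagonal? t 0) (allPairs (m * j + 2))

  m*j+2∸1 : ∀ m → m * j + 2 ∸ 1 ≡ m * j + 1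
  m*j+2∸1 m = +-∸-assoc (m * j) (s≤s z≤n)

  m*j+2≡suc : ∀ m → m * j + 2 ≡ suc (m * j + 1)
  m*j+2≡suc m = +-suc (m * j) 1

  width-full′ : ∀ m t → Full j t → #internal t ≡ m → width t ≡ m * j + 1
  width-full′ m t v s = trans (width-full t v) (cong (λ z → z * j + 1) s)

  module DissectionOf (m : ℕ) (t : Tree) (v : Full j t) (s : #internal t ≡ m) where
    n : ℕ
    n = m * j + 2

    ∈⇒diagonal : ∀ {e} → e ∈ dissectionOf m t → Diagonal t 0 e
    ∈⇒diagonal {e} p = proj₂ (∈-filter⁻ (diagonal? t 0) {xs = allPairs (m * j + 2)} p)

    diagonal-≤ : ∀ {x y} → Diagonal t 0 (x , y) → y ≤ m * j + 1
    diagonal-≤ {x} {y} p = subst (y ≤_) (width-full′ m t v s) (proj₂ (proj₂ (diagonal-range t 0 v p)))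

    diagonal-< : ∀ {x y} → Diagonal t 0 (x , y) → y < n
    diagonal-< {x} {y} p = subst (y <_) (sym (m*j+2≡suc m)) (s≤s (diagonal-≤ p))

    diagonal⇒∈ : ∀ e → Diagonal t 0 e → e ∈ dissectionOf m t
    diagonal⇒∈ (x , y) p = ∈-filter⁺ (diagonal? t 0)
        (∈-allPairs⁺ n x y (<-trans (<-trans (n<1+n x) (proj₁ (proj₂ (diagonal-range t 0 v p))))
        (diagonal-< p)) (diagonal-< p)) p

    dissectionOf-sorted : Linked _<ᴾ_ (dissectionOf m t)
    dissectionOf-sorted = linked-filter⁺ (diagonal? t 0) <ᴾ-trans (grid-sorted 0 n n)

  dissectionOf-angulation : ∀ m t → Full j t → #internal t ≡ m →
    IsAngulation (j + 2) (m * j + 2) (dissectionOf m t)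
  dissectionOf-angulation m t v s = (dissectionOf-sorted , dg , nc) , regs
    where
    open DissectionOf m t v s
    dg : ∀ e → e ∈ dissectionOf m t → IsDiagonal n e
    dg (x , y) p with diagonal-range t 0 v (∈⇒diagonal p)
    ... | _ , sxy , _ = <-trans (n<1+n x) sxy , diagonal-< (∈⇒diagonal p) , ns
      where
      ns : ¬ IsSide n x y
      ns (inj₁ e) = <-irrefl (sym e) sxy
      ns (inj₂ (e1 , e2)) = diagonal-not-closing t 0 v (∈⇒diagonal p)
          (e1 , trans e2 (trans (m*j+2∸1 m) (sym (width-full′ m t v s))))
    nc : ∀ e f → e ∈ dissectionOf m t → f ∈ dissectionOf m t → ¬ Cross e f
    nc e f p q = diagonal-noncrossing t 0 v e f (∈⇒diagonal p) (∈⇒diagonal q)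
    regs : ∀ S → IsRegion n (dissectionOf m t) S → length S ≡ j + 2
    regs S (srt , len , rng , cons , diag) = trans (region-length (suc (#internal t)) t 0 S ≤-refl v R')
        (+-comm 2 j)
      where
      R' : RegionOf 0 (0 + width t) (Diagonal t 0) S
      R' = region srt len (λ u p →
          z≤n , subst (u ≤_) (sym (width-full′ m t v s))
          (≤-pred (subst (u <_) (m*j+2≡suc m) (rng u p)))) cons'
           (λ x y xm ym dp → diag x y xm ym (diagonal⇒∈ (x , y) dp))
        where
        cons' : ∀ x y → x ∈ S → y ∈ S → x < y → ConsecIn S x y → EdgeOf 0 (0 + width t) (Diagonal t 0) x y
        cons' x y xm ym xy ci with cons x y xm ym xy ci
        ... | inj₁ (inj₁ e) = inj₁ (inj₁ e)
        ... | inj₁ (inj₂ (e1 , e2)) = inj₁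
            (inj₂ (e1 , trans e2 (trans (m*j+2∸1 m) (sym (width-full′ m t v s)))))
        ... | inj₂ p = inj₂ (∈⇒diagonal p)

  dissectionOf-injective : ∀ m t t' → Full j t → Full j t' → #internal t ≡ m → #internal t' ≡ m →
    dissectionOf m t ≡ dissectionOf m t' → t ≡ t'
  dissectionOf-injective m t t' v v' s s' e = diagonal-injective t t' 0 v v'
      (trans (width-full′ m t v s) (sym (width-full′ m t' v' s')))
    (λ d p → DissectionOf.∈⇒diagonal m t' v' s' (subst (d ∈_) e (DissectionOf.diagonal⇒∈ m t v s d p)))
    (λ d p → DissectionOf.∈⇒diagonal m t v s (subst (d ∈_) (sym e) (DissectionOf.diagonal⇒∈ m t' v' s' d p)))

  dissectionOf-surjective : ∀ m Δ → IsAngulation (j + 2) (m * j + 2) Δ → Σ Tree λ t →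
    Full j t × #internal t ≡ m × dissectionOf m t ≡ Δ
  dissectionOf-surjective m Δ ((srtΔ , dgΔ , ncΔ) , regΔ) with treeOf (suc b) 0 b (_∈ Δ) (n≤1+n b)
      (m≤n+m 1 (m * j)) H
    where
    b n : ℕ
    b = m * j + 1
    n = m * j + 2
    H : Angulated 0 b (_∈ Δ)
    H = record
      { decidable = λ e → e ∈ₚ? Δ
      ; in-range = in-range′
      ; noncrossing = ncΔ
      ; region-size = region-size′ }
      where
      in-range′ : ∀ x y → (x , y) ∈ Δ → 0 ≤ x × suc x < y × y ≤ b × ¬ (x ≡ 0 × y ≡ b)
      in-range′ x y p with dgΔ (x , y) p
      ... | xy , yn , ns = z≤n , ≤∧≢⇒< xy (λ e → ns (inj₁ (sym e))) , ≤-pred (subst (y <_) (m*j+2≡suc m) yn) ,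
                           (λ { (e1 , e2) → ns (inj₂ (e1 , trans e2 (sym (m*j+2∸1 m)))) })
      region-size′ : ∀ S → RegionOf 0 b (_∈ Δ) S → length S ≡ suc (suc j)
      region-size′ S (region srt len rng cons diag) = trans (regΔ S (srt , len , rng' , cons' , diag))
          (+-comm j 2)
        where
        rng' : ∀ u → u ∈ S → u < n
        rng' u p = subst (u <_) (sym (m*j+2≡suc m)) (s≤s (proj₂ (rng u p)))
        cons' : ∀ x y → x ∈ S → y ∈ S → x < y → ConsecIn S x y → Edge n Δ x y
        cons' x y xm ym xy ci with cons x y xm ym xy ci
        ... | inj₁ (inj₁ e) = inj₁ (inj₁ e)
        ... | inj₁ (inj₂ (e1 , e2)) = inj₁ (inj₂ (e1 , trans e2 (sym (m*j+2∸1 m))))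
        ... | inj₂ p = inj₂ p
  ... | t , v , ew , f , g = t , v , s ,
      sorted-≡ <ᴾ-trans <ᴾ-irrefl (DissectionOf.dissectionOf-sorted m t v s) srtΔ
          (λ e p → g e (DissectionOf.∈⇒diagonal m t v s p))
              (λ e p → DissectionOf.diagonal⇒∈ m t v s e (f e p))
    where
    s : #internal t ≡ m
    s = *-cancelʳ-≡ (#internal t) m j (+-cancelʳ-≡ 1 _ _ (trans (sym (width-full t v)) ew))

  dissectionOf-coding : ∀ m → Coding (FullOfSize j m) (IsAngulation (j + 2) (m * j + 2)) (dissectionOf m)
  dissectionOf-coding m = record
    { sound = λ t (full , size) → dissectionOf-angulation m t full size
    ; injective = λ t t′ (full , size) (full′ , size′) → dissectionOf-injective m t t′ full full′ size size′
    ; surjective = λ Δ ang →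
        let (t , full , size , e) = dissectionOf-surjective m Δ ang in t , (full , size) , e }

corollary2 : (j m : ℕ) → 1 ≤ j → 1 ≤ m →
    Bijection (GoodPerm j m) (IsAngulation (j + 2) (m * j + 2))
corollary2 zero m () _
corollary2 (suc k) m _ _ =
  ViaCodes.bijection (treesOfSize m) leaf (treesOfSize-complete m) (treesOfSize-sound m)
    (Vec.≡-dec _≟_) (List.≡-dec _≟ₚ_) (permOf-coding m) (dissectionOf-coding m)
  where
  open Enumeration (suc k) using (treesOfSize; treesOfSize-complete; treesOfSize-sound)
  open PermutationCode (suc k) using (permOf-coding)
  open AngulationCode k using (dissectionOf-coding)
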